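{- For $n\ge 1$, \[ P_n(x)=\frac12\sum_{j=0}^{n+1}\left\{\binom{n+1}{j}x+\binom{n}{j-1}\right\}B_{n-1}^{(n)}(x+j), \] with the convention $\binom{n}{ -1}=0$.
   Context: The Pidduck polynomials $P_n(x)$ are defined by $\sum_{k\ge0}P_k(x)\frac{t^k}{k!}=(1-t)^{ -1}\left(\frac{1+t}{1-t}\right)^x$ (equivalently, $P_n(x)$ is the Sheffer sequence for $\left(\frac{2}{e^t+1},\frac{e^t-1}{e^t+1}\right)$). For real $r$, the Bernoulli polynomials of order $r$ are defined by $\left(\frac{t}{e^t-1}\right)^re^{xt}=\sum_{n\ge0}B_n^{(r)}(x)\frac{t^n}{n!}$. -}

module Defs where

open import Data.Nat as ℕ using (ℕ; zero; suc; _≤ᵇ_; _∸_)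
open import Data.Nat.Combinatorics using (_C_)
open import Data.Integer using (ℤ; +_)
open import Data.Rational using (ℚ; _+_; _*_; _-_; -_; _/_; 0ℚ; 1ℚ)
open import Data.Bool using (if_then_else_)

ℕ→ℚ : ℕ → ℚ
ℕ→ℚ n = (+ n) / 1

-- Σ_{i=0}^{n} f i  (inclusive upper bound)
sumTo : ℕ → (ℕ → ℚ) → ℚ
sumTo zero    f = f 0
sumTo (suc n) f = sumTo n f + f (suc n)

-- formal power series over ℚ, as coefficient sequences
Series : Set
Series = ℕ → ℚ

_⊛_ : Series → Series → Series
(f ⊛ g) n = sumTo n (λ i → f i * g (n ∸ i))

oneS : Series
oneS zero    = 1ℚ
oneS (suc _) = 0ℚ

powS : Series → ℕ → Series
powS f zero    = oneS
powS f (suc r) = f ⊛ powS f r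

sgn : ℕ → ℚ
sgn zero    = 1ℚ
sgn (suc k) = - sgn k

-- substitution t ↦ -t
negArg : Series → Series
negArg f k = sgn k * f k

-- multiplicative inverse of a series with constant term 1:
-- g 0 = 1,  g (n+1) = - Σ_{k=1}^{n+1} f k * g (n+1-k).
-- recipAux f n m is correct for m ≤ n.
recipAux : Series → ℕ → Series
recipAux f zero    = λ _ → 1ℚ
recipAux f (suc n) = λ m → if m ≤ᵇ n then prev m
                           else - sumTo n (λ j → f (suc j) * prev (n ∸ j))
  where
  prev : Series
  prev = recipAux f n

recipS : Series → Series
recipS f n = recipAux f n n

invFact : ℕ → ℚ
invFact zero    = 1ℚ
invFact (suc k) = invFact k * ((+ 1) / suc k)

-- e^{a t} = Σ a^k t^k / k!
expS : ℚ → Series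
expS a k = powQ k * invFact k
  where
  powQ : ℕ → ℚ
  powQ zero    = 1ℚ
  powQ (suc j) = a * powQ j

falling : ℚ → ℕ → ℚ
falling a zero    = 1ℚ
falling a (suc k) = falling a k * (a - ℕ→ℚ k)

-- binomial series (1+t)^a = Σ binom(a,k) t^k, a ∈ ℚ
binomS : ℚ → Series
binomS a k = falling a k * invFact k

-- (e^t - 1)/t = Σ t^k/(k+1)!
expm1OverT : Series
expm1OverT k = invFact (suc k)

-- t/(e^t - 1)
bernGen : Series
bernGen = recipS expm1OverT

-- Bernoulli polynomial of (natural) order r:
-- (t/(e^t-1))^r e^{xt} = Σ B_n^{(r)}(x) t^n/n!
B : ℕ → ℕ → ℚ → ℚ
B r n x = ℕ→ℚ (n ℕ.!) * (powS bernGen r ⊛ expS x) n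

-- Pidduck polynomials:
-- Σ P_k(x) t^k/k! = (1-t)^{-1} ((1+t)/(1-t))^x = (1-t)^{-1} (1+t)^x (1-t)^{-x}
pidduckGen : ℚ → Series
pidduckGen x = (negArg (binomS (- 1ℚ)) ⊛ binomS x) ⊛ negArg (binomS (- x))

P : ℕ → ℚ → ℚ
P n x = ℕ→ℚ (n ℕ.!) * pidduckGen x n

-- binom(n, j-1) with the convention binom(n,-1) = 0
binomPred : ℕ → ℕ → ℕ
binomPred n zero    = 0
binomPred n (suc j) = n C j

module Submission where

-- All generating functions are formal power series over ℚ (coefficient
-- sequences), which form a commutative ring; a ring solver for series and the
-- Euler operator θ = t·d/dt (a derivation) are the main tools.
--
-- 1. Bernoulli side.  β = t/(e^t−1) satisfies θβ = β − tβ − β²; comparing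
--    coefficients of θ(β^(r+1)e^{yt}) gives B_m^(m+1)(y) = (y−1)⋯(y−m),
--    so the right-hand side becomes a combination of the binomial sums
--    Σ_j C(N,j)·C(y+j,m) = [t^m] (1+t)^y (2+t)^N.
-- 2. Pidduck side.  G = (1−t)^{-1}(1+t)^x(1−t)^{-x} satisfies
--    (1−t²)θG = t((1+2x)G + tG), a three-term recurrence for its
--    coefficients, which is also satisfied by c_n = Σ_i C(n,i)2^i C(x,i);
--    hence P_n(x) = n!·c_n.
-- 3. A coefficient identity for (1+t)^x(2+t)^N (absorption and Pascal's rule)
--    matches the two sides.

open import Defs
open import Level using (0ℓ)
open import Data.Nat as ℕ using (ℕ; zero; suc; _∸_; _≤_; _<_; z≤n; s≤s; _<ᵇ_)
import Data.Nat.Properties as ℕP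
open import Data.Nat.Combinatorics using (_C_; nCk+nC[k+1]≡[n+1]C[k+1]; k>n⇒nCk≡0; nCk≡nC[n∸k])
import Data.Nat.Coprimality as Coprimality
import Data.Nat.Tactic.RingSolver as ℕ-Solver
open import Data.Integer as ℤ using (ℤ)
import Data.Integer.Tactic.RingSolver as ℤ-Solver
open import Data.Rational using (ℚ; _+_; _*_; _-_; -_; _/_; 0ℚ; 1ℚ; ½; toℚᵘ; +-*-rawRing; _≟_)
open import Data.Rational.Properties
  using (toℚᵘ-injective; toℚᵘ-homo-+; toℚᵘ-homo-*; normalize-coprime; +-assoc; +-comm; +-identityˡ;
         +-identityʳ; +-inverseˡ; +-inverseʳ; *-distribˡ-+; *-assoc; *-comm; *-zeroˡ; *-zeroʳ;
         *-identityˡ; *-identityʳ)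
import Data.Rational.Unnormalised as ℚᵘ
import Data.Rational.Unnormalised.Properties as ℚᵘP
open import Data.Rational.Solver
open +-*-Solver
open import Data.Bool using (false)
open import Data.Bool.Properties using (T-≡)
open import Data.Maybe using (Maybe; just; nothing)
open import Data.Product using (_×_; _,_; proj₁)
open import Function.Bundles using (Equivalence)
open import Relation.Nullary using (yes; no)
open import Relation.Binary.PropositionalEquality
open import Algebra.Bundles using (CommutativeRing)
import Algebra.Solver.Ring.AlmostCommutativeRing as ACR

-- The embedding ℕ→ℚ n = n/1 is a semiring homomorphism.  Since (ℤ.+ n) / 1 is
-- defined by normalisation, we compute through the unnormalised rationals.

toℚᵘ-ℕ→ℚ : ∀ n → toℚᵘ (ℕ→ℚ n) ≡ ℚᵘ.mkℚᵘ (ℤ.+ n) 0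
toℚᵘ-ℕ→ℚ n = cong toℚᵘ (normalize-coprime (Coprimality.sym (Coprimality.1-coprimeTo n)))

ℕ→ℚ-suc : ∀ n → ℕ→ℚ (suc n) ≡ 1ℚ + ℕ→ℚ n
ℕ→ℚ-suc n = toℚᵘ-injective (begin
    toℚᵘ (ℕ→ℚ (suc n))                    ≡⟨ toℚᵘ-ℕ→ℚ (suc n) ⟩
    ℚᵘ.mkℚᵘ (ℤ.+ suc n) 0                  ≈⟨ ℚᵘ.*≡* (cross-multiplied (ℤ.+ n)) ⟩
    ℚᵘ.mkℚᵘ (ℤ.+ 1) 0 ℚᵘ.+ ℚᵘ.mkℚᵘ (ℤ.+ n) 0  ≡⟨ cong (ℚᵘ.mkℚᵘ (ℤ.+ 1) 0 ℚᵘ.+_) (sym (toℚᵘ-ℕ→ℚ n)) ⟩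
    toℚᵘ 1ℚ ℚᵘ.+ toℚᵘ (ℕ→ℚ n)             ≈⟨ ℚᵘP.≃-sym (toℚᵘ-homo-+ 1ℚ (ℕ→ℚ n)) ⟩
    toℚᵘ (1ℚ + ℕ→ℚ n)                     ∎)
  where
  open import Relation.Binary.Reasoning.Setoid ℚᵘP.≃-setoid
  cross-multiplied : ∀ (z : ℤ) → (ℤ.+ 1 ℤ.+ z) ℤ.* ℤ.+ 1 ≡ (ℤ.+ 1 ℤ.* ℤ.+ 1 ℤ.+ z ℤ.* ℤ.+ 1) ℤ.* ℤ.+ 1
  cross-multiplied = ℤ-Solver.solve-∀

inv-suc : ∀ k → (ℤ.+ 1 / suc k) * ℕ→ℚ (suc k) ≡ 1ℚ
inv-suc k = toℚᵘ-injective (begin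
    toℚᵘ ((ℤ.+ 1 / suc k) * ℕ→ℚ (suc k))              ≈⟨ toℚᵘ-homo-* (ℤ.+ 1 / suc k) (ℕ→ℚ (suc k)) ⟩
    toℚᵘ (ℤ.+ 1 / suc k) ℚᵘ.* toℚᵘ (ℕ→ℚ (suc k))     ≡⟨ cong₂ ℚᵘ._*_ toℚᵘ-inv (toℚᵘ-ℕ→ℚ (suc k)) ⟩
    ℚᵘ.mkℚᵘ (ℤ.+ 1) k ℚᵘ.* ℚᵘ.mkℚᵘ (ℤ.+ suc k) 0        ≈⟨ ℚᵘ.*≡* (cong (λ m → ℤ.+ suc m) (cross-multiplied k)) ⟩
    ℚᵘ.mkℚᵘ (ℤ.+ 1) 0                                 ∎)
  where
  open import Relation.Binary.Reasoning.Setoid ℚᵘP.≃-setoid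
  toℚᵘ-inv : toℚᵘ (ℤ.+ 1 / suc k) ≡ ℚᵘ.mkℚᵘ (ℤ.+ 1) k
  toℚᵘ-inv = cong toℚᵘ (normalize-coprime (Coprimality.1-coprimeTo (suc k)))
  cross-multiplied : ∀ k → (k ℕ.+ 0 ℕ.* suc k) ℕ.* 1 ≡ k ℕ.* 1 ℕ.+ 0 ℕ.* suc (k ℕ.* 1)
  cross-multiplied = ℕ-Solver.solve-∀

ℕ→ℚ-+ : ∀ m n → ℕ→ℚ (m ℕ.+ n) ≡ ℕ→ℚ m + ℕ→ℚ n
ℕ→ℚ-+ zero    n = sym (+-identityˡ (ℕ→ℚ n))
ℕ→ℚ-+ (suc m) n = begin
  ℕ→ℚ (suc (m ℕ.+ n))       ≡⟨ ℕ→ℚ-suc (m ℕ.+ n) ⟩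
  1ℚ + ℕ→ℚ (m ℕ.+ n)        ≡⟨ cong (1ℚ +_) (ℕ→ℚ-+ m n) ⟩
  1ℚ + (ℕ→ℚ m + ℕ→ℚ n)      ≡⟨ sym (+-assoc 1ℚ (ℕ→ℚ m) (ℕ→ℚ n)) ⟩
  (1ℚ + ℕ→ℚ m) + ℕ→ℚ n      ≡⟨ cong (_+ ℕ→ℚ n) (sym (ℕ→ℚ-suc m)) ⟩
  ℕ→ℚ (suc m) + ℕ→ℚ n       ∎
  where open ≡-Reasoning

ℕ→ℚ-* : ∀ m n → ℕ→ℚ (m ℕ.* n) ≡ ℕ→ℚ m * ℕ→ℚ n
ℕ→ℚ-* zero    n = sym (*-zeroˡ (ℕ→ℚ n))
ℕ→ℚ-* (suc m) n = begin
  ℕ→ℚ (n ℕ.+ m ℕ.* n)       ≡⟨ ℕ→ℚ-+ n (m ℕ.* n) ⟩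
  ℕ→ℚ n + ℕ→ℚ (m ℕ.* n)     ≡⟨ cong (ℕ→ℚ n +_) (ℕ→ℚ-* m n) ⟩
  ℕ→ℚ n + ℕ→ℚ m * ℕ→ℚ n     ≡⟨ solve 2 (λ a b → b :+ a :* b := (con 1ℚ :+ a) :* b) refl (ℕ→ℚ m) (ℕ→ℚ n) ⟩
  (1ℚ + ℕ→ℚ m) * ℕ→ℚ n      ≡⟨ cong (_* ℕ→ℚ n) (sym (ℕ→ℚ-suc m)) ⟩
  ℕ→ℚ (suc m) * ℕ→ℚ n       ∎
  where open ≡-Reasoning

ℕ→ℚ-∸ : ∀ m n → n ≤ m → ℕ→ℚ (m ∸ n) ≡ ℕ→ℚ m - ℕ→ℚ n
ℕ→ℚ-∸ m       zero    _         = solve 1 (λ a → a := a :- con 0ℚ) refl (ℕ→ℚ m)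
ℕ→ℚ-∸ (suc m) (suc n) (s≤s n≤m) = begin
  ℕ→ℚ (m ∸ n)                   ≡⟨ ℕ→ℚ-∸ m n n≤m ⟩
  ℕ→ℚ m - ℕ→ℚ n                 ≡⟨ solve 2 (λ a b → a :- b := (con 1ℚ :+ a) :- (con 1ℚ :+ b)) refl (ℕ→ℚ m) (ℕ→ℚ n) ⟩
  (1ℚ + ℕ→ℚ m) - (1ℚ + ℕ→ℚ n)   ≡⟨ sym (cong₂ _-_ (ℕ→ℚ-suc m) (ℕ→ℚ-suc n)) ⟩
  ℕ→ℚ (suc m) - ℕ→ℚ (suc n)     ∎
  where open ≡-Reasoning

*-cancelˡ-suc : ∀ k {u v} → ℕ→ℚ (suc k) * u ≡ ℕ→ℚ (suc k) * v → u ≡ v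
*-cancelˡ-suc k {u} {v} eq = begin
  u                    ≡⟨ sym (*-identityˡ u) ⟩
  1ℚ * u               ≡⟨ cong (_* u) (sym (inv-suc k)) ⟩
  (i * ℕ→ℚ (suc k)) * u  ≡⟨ *-assoc i (ℕ→ℚ (suc k)) u ⟩
  i * (ℕ→ℚ (suc k) * u)  ≡⟨ cong (i *_) eq ⟩
  i * (ℕ→ℚ (suc k) * v)  ≡⟨ sym (*-assoc i (ℕ→ℚ (suc k)) v) ⟩
  (i * ℕ→ℚ (suc k)) * v  ≡⟨ cong (_* v) (inv-suc k) ⟩
  1ℚ * v               ≡⟨ *-identityˡ v ⟩
  v                    ∎
  where
  open ≡-Reasoning
  i : ℚ
  i = ℤ.+ 1 / suc k

invFact-suc : ∀ k → ℕ→ℚ (suc k) * invFact (suc k) ≡ invFact k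
invFact-suc k = begin
  ℕ→ℚ (suc k) * (invFact k * (ℤ.+ 1 / suc k))   ≡⟨ solve 3 (λ a b c → a :* (b :* c) := b :* (c :* a)) refl (ℕ→ℚ (suc k)) (invFact k) (ℤ.+ 1 / suc k) ⟩
  invFact k * ((ℤ.+ 1 / suc k) * ℕ→ℚ (suc k))   ≡⟨ cong (invFact k *_) (inv-suc k) ⟩
  invFact k * 1ℚ                              ≡⟨ *-identityʳ (invFact k) ⟩
  invFact k                                   ∎
  where open ≡-Reasoning

fact*invFact : ∀ k → ℕ→ℚ (k ℕ.!) * invFact k ≡ 1ℚ
fact*invFact zero    = refl
fact*invFact (suc k) = begin
  ℕ→ℚ (suc k ℕ.* k ℕ.!) * invFact (suc k)         ≡⟨ cong (_* invFact (suc k)) (ℕ→ℚ-* (suc k) (k ℕ.!)) ⟩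
  ℕ→ℚ (suc k) * ℕ→ℚ (k ℕ.!) * invFact (suc k)     ≡⟨ solve 3 (λ a b c → a :* b :* c := b :* (a :* c)) refl (ℕ→ℚ (suc k)) (ℕ→ℚ (k ℕ.!)) (invFact (suc k)) ⟩
  ℕ→ℚ (k ℕ.!) * (ℕ→ℚ (suc k) * invFact (suc k))   ≡⟨ cong (ℕ→ℚ (k ℕ.!) *_) (invFact-suc k) ⟩
  ℕ→ℚ (k ℕ.!) * invFact k                         ≡⟨ fact*invFact k ⟩
  1ℚ                                              ∎
  where open ≡-Reasoning

sum-cong : ∀ n {f g : ℕ → ℚ} → (∀ i → i ≤ n → f i ≡ g i) → sumTo n f ≡ sumTo n g
sum-cong zero    eq = eq 0 z≤n
sum-cong (suc n) eq = cong₂ _+_ (sum-cong n (λ i i≤n → eq i (ℕP.m≤n⇒m≤1+n i≤n))) (eq (suc n) ℕP.≤-refl)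

sum-+ : ∀ n (f g : ℕ → ℚ) → sumTo n (λ i → f i + g i) ≡ sumTo n f + sumTo n g
sum-+ zero    f g = refl
sum-+ (suc n) f g = trans (cong (_+ (f (suc n) + g (suc n))) (sum-+ n f g))
  (solve 4 (λ a b c d → (a :+ b) :+ (c :+ d) := (a :+ c) :+ (b :+ d)) refl
     (sumTo n f) (sumTo n g) (f (suc n)) (g (suc n)))

sum-*ˡ : ∀ n (a : ℚ) (f : ℕ → ℚ) → sumTo n (λ i → a * f i) ≡ a * sumTo n f
sum-*ˡ zero    a f = refl
sum-*ˡ (suc n) a f = trans (cong (_+ (a * f (suc n))) (sum-*ˡ n a f))
  (sym (*-distribˡ-+ a (sumTo n f) (f (suc n))))

sum-*ʳ : ∀ n (a : ℚ) (f : ℕ → ℚ) → sumTo n (λ i → f i * a) ≡ sumTo n f * a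
sum-*ʳ n a f = begin
  sumTo n (λ i → f i * a)   ≡⟨ sum-cong n (λ i _ → *-comm (f i) a) ⟩
  sumTo n (λ i → a * f i)   ≡⟨ sum-*ˡ n a f ⟩
  a * sumTo n f             ≡⟨ *-comm a (sumTo n f) ⟩
  sumTo n f * a             ∎
  where open ≡-Reasoning

sum-shift : ∀ n (f : ℕ → ℚ) → sumTo (suc n) f ≡ f 0 + sumTo n (λ i → f (suc i))
sum-shift zero    f = refl
sum-shift (suc n) f = trans (cong (_+ f (suc (suc n))) (sum-shift n f))
  (+-assoc (f 0) (sumTo n (λ i → f (suc i))) (f (suc (suc n))))

sum-drop-last : ∀ n (f : ℕ → ℚ) → f (suc n) ≡ 0ℚ → sumTo (suc n) f ≡ sumTo n f
sum-drop-last n f f₊≡0 = trans (cong (sumTo n f +_) f₊≡0) (+-identityʳ (sumTo n f))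

sum-first : ∀ n (f : ℕ → ℚ) → (∀ i → f (suc i) ≡ 0ℚ) → sumTo n f ≡ f 0
sum-first zero    f f0 = refl
sum-first (suc n) f f0 = trans (cong₂ _+_ (sum-first n f f0) (f0 n)) (+-identityʳ (f 0))

sum-reverse : ∀ n (f : ℕ → ℚ) → sumTo n f ≡ sumTo n (λ i → f (n ∸ i))
sum-reverse zero    f = refl
sum-reverse (suc n) f = begin
  sumTo n f + f (suc n)                      ≡⟨ +-comm (sumTo n f) (f (suc n)) ⟩
  f (suc n) + sumTo n f                      ≡⟨ cong (f (suc n) +_) (sum-reverse n f) ⟩
  f (suc n) + sumTo n (λ i → f (n ∸ i))      ≡⟨ sym (sum-shift n (λ i → f (suc n ∸ i))) ⟩
  sumTo (suc n) (λ i → f (suc n ∸ i))        ∎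
  where open ≡-Reasoning

sum-exchange : ∀ n (a : ℕ → ℕ → ℚ) →
  sumTo n (λ i → sumTo i (λ j → a j i)) ≡ sumTo n (λ j → sumTo (n ∸ j) (λ k → a j (j ℕ.+ k)))
sum-exchange zero    a = refl
sum-exchange (suc n) a = begin
  sumTo n (λ i → sumTo i (λ j → a j i)) + sumTo (suc n) (λ j → a j (suc n))
    ≡⟨ cong (_+ sumTo (suc n) (λ j → a j (suc n))) (sum-exchange n a) ⟩
  T n + (sumTo n (λ j → a j (suc n)) + a (suc n) (suc n))
    ≡⟨ sym (+-assoc (T n) _ _) ⟩
  (T n + sumTo n (λ j → a j (suc n))) + a (suc n) (suc n)
    ≡⟨ cong₂ _+_ (sym (sum-+ n _ _)) (cong (a (suc n)) (sym (ℕP.+-identityʳ (suc n)))) ⟩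
  sumTo n (λ j → row j (n ∸ j) + a j (suc n)) + a (suc n) (suc n ℕ.+ 0)
    ≡⟨ cong₂ _+_ (sum-cong n extend-row) (cong (λ z → row (suc n) z) (sym (ℕP.n∸n≡0 n))) ⟩
  T (suc n) ∎
  where
  open ≡-Reasoning
  row : ℕ → ℕ → ℚ
  row j m = sumTo m (λ k → a j (j ℕ.+ k))
  T : ℕ → ℚ
  T m = sumTo m (λ j → row j (m ∸ j))
  extend-row : ∀ j → j ≤ n → row j (n ∸ j) + a j (suc n) ≡ row j (suc n ∸ j)
  extend-row j j≤n rewrite ℕP.+-∸-assoc 1 j≤n =
    cong (λ z → row j (n ∸ j) + a j z)
      (trans (cong suc (sym (ℕP.m+[n∸m]≡n j≤n))) (sym (ℕP.+-suc j (n ∸ j))))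

infixl 6 _+S_
infix  8 -S_

_+S_ : Series → Series → Series
(f +S g) k = f k + g k

-S_ : Series → Series
(-S f) k = - f k

0S : Series
0S _ = 0ℚ

cS : ℚ → Series
cS c zero    = c
cS c (suc _) = 0ℚ

tS : Series
tS zero          = 0ℚ
tS (suc zero)    = 1ℚ
tS (suc (suc _)) = 0ℚ

⊛-concentrated : ∀ g f → (∀ i → g (suc i) ≡ 0ℚ) → ∀ n → (g ⊛ f) n ≡ g 0 * f n
⊛-concentrated g f g₊≡0 n =
  sum-first n (λ i → g i * f (n ∸ i)) (λ i → trans (cong (_* f (n ∸ suc i)) (g₊≡0 i)) (*-zeroˡ (f (n ∸ suc i))))

cS-⊛ : ∀ c f n → (cS c ⊛ f) n ≡ c * f n
cS-⊛ c f = ⊛-concentrated (cS c) f (λ _ → refl)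

tS-⊛-zero : ∀ f → (tS ⊛ f) 0 ≡ 0ℚ
tS-⊛-zero f = *-zeroˡ (f 0)

tS-⊛-suc : ∀ f k → (tS ⊛ f) (suc k) ≡ f k
tS-⊛-suc f k = begin
  (tS ⊛ f) (suc k)                                  ≡⟨ sum-shift k (λ i → tS i * f (suc k ∸ i)) ⟩
  0ℚ * f (suc k) + ((λ i → tS (suc i)) ⊛ f) k        ≡⟨ cong₂ _+_ (*-zeroˡ (f (suc k))) (⊛-concentrated (λ i → tS (suc i)) f tS₊ k) ⟩
  0ℚ + 1ℚ * f k                                     ≡⟨ trans (+-identityˡ _) (*-identityˡ (f k)) ⟩
  f k                                               ∎
  where
  open ≡-Reasoning
  tS₊ : ∀ i → tS (suc (suc i)) ≡ 0ℚ
  tS₊ _ = refl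

⊛-cong : ∀ {f f′ g g′} → f ≗ f′ → g ≗ g′ → (f ⊛ g) ≗ (f′ ⊛ g′)
⊛-cong f≗f′ g≗g′ n = sum-cong n (λ i _ → cong₂ _*_ (f≗f′ i) (g≗g′ (n ∸ i)))

-- Congruences with the fixed factor explicit (so that they can be used in
-- reasoning chains without unification problems).
⊛-congˡ : ∀ h {f g} → f ≗ g → (h ⊛ f) ≗ (h ⊛ g)
⊛-congˡ h f≗g n = sum-cong n (λ i _ → cong (h i *_) (f≗g (n ∸ i)))

⊛-congʳ : ∀ h {f g} → f ≗ g → (f ⊛ h) ≗ (g ⊛ h)
⊛-congʳ h f≗g n = sum-cong n (λ i _ → cong (_* h (n ∸ i)) (f≗g i))

+S-cong : ∀ {f f′ g g′} → f ≗ f′ → g ≗ g′ → (f +S g) ≗ (f′ +S g′)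
+S-cong f≗f′ g≗g′ k = cong₂ _+_ (f≗f′ k) (g≗g′ k)

+S-congˡ : ∀ h {f g} → f ≗ g → (h +S f) ≗ (h +S g)
+S-congˡ h f≗g k = cong (h k +_) (f≗g k)

+S-congʳ : ∀ h {f g} → f ≗ g → (f +S h) ≗ (g +S h)
+S-congʳ h f≗g k = cong (_+ h k) (f≗g k)

-S-cong : ∀ {f g} → f ≗ g → (-S f) ≗ (-S g)
-S-cong f≗g k = cong -_ (f≗g k)

⊛-comm : ∀ f g → (f ⊛ g) ≗ (g ⊛ f)
⊛-comm f g n = trans (sum-reverse n (λ i → f i * g (n ∸ i)))
  (sum-cong n (λ i i≤n → trans (cong (λ j → f (n ∸ i) * g j) (ℕP.m∸[m∸n]≡n i≤n)) (*-comm (f (n ∸ i)) (g i))))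

⊛-distribˡ : ∀ f g h → (f ⊛ (g +S h)) ≗ ((f ⊛ g) +S (f ⊛ h))
⊛-distribˡ f g h n = trans (sum-cong n (λ i _ → *-distribˡ-+ (f i) (g (n ∸ i)) (h (n ∸ i))))
  (sum-+ n (λ i → f i * g (n ∸ i)) (λ i → f i * h (n ∸ i)))

⊛-distribʳ : ∀ f g h → ((g +S h) ⊛ f) ≗ ((g ⊛ f) +S (h ⊛ f))
⊛-distribʳ f g h n = trans (⊛-comm (g +S h) f n)
  (trans (⊛-distribˡ f g h n) (cong₂ _+_ (⊛-comm f g n) (⊛-comm f h n)))

⊛-identityˡ : ∀ f → (oneS ⊛ f) ≗ f
⊛-identityˡ f n = trans (⊛-concentrated oneS f (λ _ → refl) n) (*-identityˡ (f n))

⊛-assoc : ∀ f g h → ((f ⊛ g) ⊛ h) ≗ (f ⊛ (g ⊛ h))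
⊛-assoc f g h n = begin
  sumTo n (λ i → sumTo i (λ j → f j * g (i ∸ j)) * h (n ∸ i))
    ≡⟨ sum-cong n (λ i _ → sym (sum-*ʳ i (h (n ∸ i)) (λ j → f j * g (i ∸ j)))) ⟩
  sumTo n (λ i → sumTo i (λ j → f j * g (i ∸ j) * h (n ∸ i)))
    ≡⟨ sum-exchange n (λ j i → f j * g (i ∸ j) * h (n ∸ i)) ⟩
  sumTo n (λ j → sumTo (n ∸ j) (λ k → f j * g ((j ℕ.+ k) ∸ j) * h (n ∸ (j ℕ.+ k))))
    ≡⟨ sum-cong n (λ j _ → sum-cong (n ∸ j) (λ k _ → reindex j k)) ⟩
  sumTo n (λ j → sumTo (n ∸ j) (λ k → f j * (g k * h (n ∸ j ∸ k))))
    ≡⟨ sum-cong n (λ j _ → sum-*ˡ (n ∸ j) (f j) (λ k → g k * h (n ∸ j ∸ k))) ⟩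
  sumTo n (λ j → f j * sumTo (n ∸ j) (λ k → g k * h (n ∸ j ∸ k))) ∎
  where
  open ≡-Reasoning
  reindex : ∀ j k → f j * g ((j ℕ.+ k) ∸ j) * h (n ∸ (j ℕ.+ k)) ≡ f j * (g k * h (n ∸ j ∸ k))
  reindex j k = trans (cong₂ (λ a b → f j * g a * h b) (ℕP.m+n∸m≡n j k) (sym (ℕP.∸-+-assoc n j k)))
                      (*-assoc (f j) (g k) (h (n ∸ j ∸ k)))

Series-ring : CommutativeRing 0ℓ 0ℓ
Series-ring = record
  { Carrier = Series
  ; _≈_ = _≗_
  ; _+_ = _+S_
  ; _*_ = _⊛_
  ; -_ = -S_
  ; 0# = 0S
  ; 1# = oneS
  ; isCommutativeRing = record
    { isRing = record
      { +-isAbelianGroup = record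
        { isGroup = record
          { isMonoid = record
            { isSemigroup = record
              { isMagma = record
                { isEquivalence = record { refl = λ _ → refl ; sym = λ p x → sym (p x) ; trans = λ p q x → trans (p x) (q x) }
                ; ∙-cong = λ p q x → cong₂ _+_ (p x) (q x) }
              ; assoc = λ f g h x → +-assoc (f x) (g x) (h x) }
            ; identity = (λ f x → +-identityˡ (f x)) , (λ f x → +-identityʳ (f x)) }
          ; inverse = (λ f x → +-inverseˡ (f x)) , (λ f x → +-inverseʳ (f x))
          ; ⁻¹-cong = λ p x → cong -_ (p x) }
        ; comm = λ f g x → +-comm (f x) (g x) }
      ; *-cong = ⊛-cong
      ; *-assoc = ⊛-assoc
      ; *-identity = ⊛-identityˡ , (λ f x → trans (⊛-comm f oneS x) (⊛-identityˡ f x))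
      ; distrib = ⊛-distribˡ , ⊛-distribʳ }
    ; *-comm = ⊛-comm } }

-- Rational constants embed into series as a ring homomorphism; this lets the
-- ring solver normalise series identities with rational coefficients.
module SeriesSolver where
  private
    ring : ACR.AlmostCommutativeRing 0ℓ 0ℓ
    ring = ACR.fromCommutativeRing Series-ring

    cS-homomorphism : +-*-rawRing ACR.-Raw-AlmostCommutative⟶ ring
    cS-homomorphism = record
      { ⟦_⟧    = cS
      ; +-homo = λ a b → λ { zero → refl ; (suc _) → refl }
      ; *-homo = λ a b k → sym (trans (cS-⊛ a (cS b) k) (scale {a} {b} k))
      ; -‿homo = λ a → λ { zero → refl ; (suc _) → refl }
      ; 0-homo = λ { zero → refl ; (suc _) → refl }
      ; 1-homo = λ { zero → refl ; (suc _) → refl } }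
      where
      scale : ∀ {a b} k → a * cS b k ≡ cS (a * b) k
      scale zero    = refl
      scale {a} (suc k) = *-zeroʳ a

    cS-equal? : ∀ a b → Maybe (cS a ≗ cS b)
    cS-equal? a b with a ≟ b
    ... | yes a≡b = just (λ k → cong (λ c → cS c k) a≡b)
    ... | no _    = nothing

  open import Algebra.Solver.Ring +-*-rawRing ring cS-homomorphism cS-equal? public

private
  module R = CommutativeRing Series-ring
  module S = SeriesSolver

-- The Euler operator θ = t·d/dt acts on coefficients as  k ↦ k · f k;
-- it is a derivation of the series ring.
θ : Series → Series
θ f k = ℕ→ℚ k * f k

θ-cong : ∀ {f g} → f ≗ g → θ f ≗ θ g
θ-cong f≗g k = cong (ℕ→ℚ k *_) (f≗g k)

θ-constant : ∀ c → θ (cS c) ≗ cS 0ℚ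
θ-constant c zero    = *-zeroˡ c
θ-constant c (suc k) = *-zeroʳ (ℕ→ℚ (suc k))

θ-leibniz : ∀ f g → θ (f ⊛ g) ≗ ((θ f ⊛ g) +S (f ⊛ θ g))
θ-leibniz f g n = begin
  ℕ→ℚ n * sumTo n (λ i → f i * g (n ∸ i))                  ≡⟨ sym (sum-*ˡ n (ℕ→ℚ n) _) ⟩
  sumTo n (λ i → ℕ→ℚ n * (f i * g (n ∸ i)))                ≡⟨ sum-cong n split ⟩
  sumTo n (λ i → ℕ→ℚ i * f i * g (n ∸ i) + f i * θ g (n ∸ i)) ≡⟨ sum-+ n _ _ ⟩
  (θ f ⊛ g) n + (f ⊛ θ g) n                                  ∎
  where
  open ≡-Reasoning
  -- n = i + (n - i) for every term of the Cauchy product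
  split : ∀ i → i ≤ n → ℕ→ℚ n * (f i * g (n ∸ i)) ≡ ℕ→ℚ i * f i * g (n ∸ i) + f i * θ g (n ∸ i)
  split i i≤n rewrite ℕ→ℚ-∸ n i i≤n =
    solve 4 (λ N I a b → N :* (a :* b) := I :* a :* b :+ a :* ((N :- I) :* b)) refl
      (ℕ→ℚ n) (ℕ→ℚ i) (f i) (g (n ∸ i))

-- recipS f is a multiplicative inverse of f when f 0 = 1.  The table
-- recipAux f n agrees with recipS below index n, which gives the defining
-- recursion of recipS.
recipAux-stable : ∀ f n m → m ≤ n → recipAux f n m ≡ recipS f m
recipAux-stable f zero    zero z≤n = refl
recipAux-stable f (suc n) m m≤1+n with m ℕ.≤? n
... | yes m≤n rewrite Equivalence.to T-≡ (ℕP.≤⇒≤ᵇ m≤n) = recipAux-stable f n m m≤n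
... | no  m≰n rewrite ℕP.≤-antisym m≤1+n (ℕP.≰⇒> m≰n) = refl

n<ᵇn≡false : ∀ n → (n <ᵇ n) ≡ false
n<ᵇn≡false zero    = refl
n<ᵇn≡false (suc n) = n<ᵇn≡false n

recipS-suc : ∀ f n → recipS f (suc n) ≡ - sumTo n (λ j → f (suc j) * recipS f (n ∸ j))
recipS-suc f n rewrite n<ᵇn≡false n =
  cong -_ (sum-cong n (λ j _ → cong (f (suc j) *_) (recipAux-stable f n (n ∸ j) (ℕP.m∸n≤m n j))))

recipS-inverse : ∀ f → f 0 ≡ 1ℚ → (f ⊛ recipS f) ≗ cS 1ℚ
recipS-inverse f f0≡1 zero    = trans (cong (_* 1ℚ) f0≡1) refl
recipS-inverse f f0≡1 (suc n) = begin
  (f ⊛ recipS f) (suc n)             ≡⟨ sum-shift n (λ i → f i * recipS f (suc n ∸ i)) ⟩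
  f 0 * recipS f (suc n) + tail      ≡⟨ cong₂ (λ a b → a * b + tail) f0≡1 (recipS-suc f n) ⟩
  1ℚ * (- tail) + tail               ≡⟨ solve 1 (λ s → con 1ℚ :* (:- s) :+ s := con 0ℚ) refl tail ⟩
  0ℚ                                 ∎
  where
  open ≡-Reasoning
  tail : ℚ
  tail = sumTo n (λ j → f (suc j) * recipS f (n ∸ j))

θ-powS : ∀ f r → θ (powS f (suc r)) ≗ (cS (ℕ→ℚ (suc r)) ⊛ (θ f ⊛ powS f r))
θ-powS f zero = begin
  θ (f ⊛ oneS)                          ≈⟨ θ-leibniz f oneS ⟩
  (θ f ⊛ oneS) +S (f ⊛ θ oneS)          ≈⟨ +S-congˡ (θ f ⊛ oneS) (⊛-congˡ f θ-one) ⟩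
  (θ f ⊛ oneS) +S (f ⊛ cS 0ℚ)          ≈⟨ S.solve 2 (λ g h → g S.:+ h S.:* S.con 0ℚ S.:= S.con 1ℚ S.:* g) (λ _ → refl) (θ f ⊛ oneS) f ⟩
  cS 1ℚ ⊛ (θ f ⊛ oneS)                  ∎
  where
  open import Relation.Binary.Reasoning.Setoid R.setoid
  θ-one : θ oneS ≗ cS 0ℚ
  θ-one zero    = refl
  θ-one (suc k) = *-zeroʳ (ℕ→ℚ (suc k))
θ-powS f (suc r) = begin
  θ (f ⊛ fʳ⁺¹)                              ≈⟨ θ-leibniz f fʳ⁺¹ ⟩
  (θ f ⊛ fʳ⁺¹) +S (f ⊛ θ fʳ⁺¹)              ≈⟨ +S-congˡ (θ f ⊛ fʳ⁺¹) (⊛-congˡ f (θ-powS f r)) ⟩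
  (θ f ⊛ fʳ⁺¹) +S (f ⊛ (c ⊛ (θ f ⊛ fʳ)))    ≈⟨ S.solve 4 (λ g h p c → g S.:* (h S.:* p) S.:+ h S.:* (c S.:* (g S.:* p)) S.:= (S.con 1ℚ S.:+ c) S.:* (g S.:* (h S.:* p))) (λ _ → refl) (θ f) f fʳ c ⟩
  (cS 1ℚ +S c) ⊛ (θ f ⊛ fʳ⁺¹)               ≈⟨ ⊛-congʳ (θ f ⊛ fʳ⁺¹) constant-sum ⟩
  cS (ℕ→ℚ (suc (suc r))) ⊛ (θ f ⊛ fʳ⁺¹)     ∎
  where
  open import Relation.Binary.Reasoning.Setoid R.setoid
  fʳ fʳ⁺¹ c : Series
  fʳ = powS f r
  fʳ⁺¹ = powS f (suc r)
  c = cS (ℕ→ℚ (suc r))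
  constant-sum : (cS 1ℚ +S c) ≗ cS (ℕ→ℚ (suc (suc r)))
  constant-sum zero    = sym (ℕ→ℚ-suc (suc r))
  constant-sum (suc k) = refl

θ-expS : ∀ y → θ (expS y) ≗ (cS y ⊛ (tS ⊛ expS y))
θ-expS y zero    = sym (trans (cS-⊛ y (tS ⊛ expS y) 0) (trans (cong (y *_) (tS-⊛-zero (expS y))) (*-zeroʳ y)))
θ-expS y (suc k) = trans (lower-power _) (sym (trans (cS-⊛ y (tS ⊛ expS y) (suc k)) (cong (y *_) (tS-⊛-suc (expS y) k))))
  where
  lower-power : ∀ a → ℕ→ℚ (suc k) * ((y * a) * invFact (suc k)) ≡ y * (a * invFact k)
  lower-power a = trans (solve 4 (λ n y a f → n :* ((y :* a) :* f) := y :* (a :* (n :* f))) refl (ℕ→ℚ (suc k)) y a (invFact (suc k)))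
                        (cong (λ z → y * (a * z)) (invFact-suc k))

private
  E β : Series
  E = expm1OverT
  β = bernGen

E⊛β : (E ⊛ β) ≗ cS 1ℚ
E⊛β = recipS-inverse E refl

-- t·E = e^t − 1 gives  θE = 1 + tE − E.
θ-expm1OverT : θ E ≗ ((cS 1ℚ +S (tS ⊛ E)) +S (-S E))
θ-expm1OverT zero    = sym (cong (λ z → 1ℚ + z + (- 1ℚ)) (tS-⊛-zero E))
θ-expm1OverT (suc k) = begin
  ℕ→ℚ (suc k) * E (suc k)                   ≡⟨ solve 2 (λ n e → n :* e := con 0ℚ :+ (con 1ℚ :+ n) :* e :+ (:- e)) refl (ℕ→ℚ (suc k)) (E (suc k)) ⟩
  0ℚ + (1ℚ + ℕ→ℚ (suc k)) * E (suc k) + (- E (suc k))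
    ≡⟨ cong (λ z → 0ℚ + z * E (suc k) + (- E (suc k))) (sym (ℕ→ℚ-suc (suc k))) ⟩
  0ℚ + ℕ→ℚ (suc (suc k)) * E (suc k) + (- E (suc k))
    ≡⟨ cong (λ z → 0ℚ + z + (- E (suc k))) (trans (invFact-suc (suc k)) (sym (tS-⊛-suc E k))) ⟩
  0ℚ + (tS ⊛ E) (suc k) + (- E (suc k))    ∎
  where open ≡-Reasoning

θ-bernGen : θ β ≗ ((β +S (-S (tS ⊛ β))) +S (-S (β ⊛ β)))
θ-bernGen = begin
  θ β
    ≈⟨ S.solve 1 (λ x → x S.:= S.con 1ℚ S.:* x) (λ _ → refl) (θ β) ⟩
  cS 1ℚ ⊛ θ β
    ≈⟨ ⊛-congʳ (θ β) (R.sym (R.trans (⊛-comm β E) E⊛β)) ⟩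
  (β ⊛ E) ⊛ θ β
    ≈⟨ S.solve 4 (λ b e x y → (b S.:* e) S.:* x S.:= b S.:* (y S.:* b S.:+ e S.:* x) S.:- b S.:* (y S.:* b)) (λ _ → refl) β E (θ β) (θ E) ⟩
  (β ⊛ ((θ E ⊛ β) +S (E ⊛ θ β))) +S (-S (β ⊛ (θ E ⊛ β)))
    ≈⟨ +S-cong (⊛-congˡ β derivative-of-one) (-S-cong (⊛-congˡ β (⊛-congʳ β θ-expm1OverT))) ⟩
  (β ⊛ cS 0ℚ) +S (-S (β ⊛ (((cS 1ℚ +S (tS ⊛ E)) +S (-S E)) ⊛ β)))
    ≈⟨ S.solve 3 (λ b e t → b S.:* S.con 0ℚ S.:- b S.:* (((S.con 1ℚ S.:+ t S.:* e) S.:- e) S.:* b) S.:= ((S.:- (b S.:* b)) S.:- t S.:* b S.:* (e S.:* b)) S.:+ b S.:* (e S.:* b)) (λ _ → refl) β E tS ⟩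
  ((-S (β ⊛ β)) +S (-S ((tS ⊛ β) ⊛ (E ⊛ β)))) +S (β ⊛ (E ⊛ β))
    ≈⟨ +S-cong (+S-congˡ (-S (β ⊛ β)) (-S-cong (⊛-congˡ (tS ⊛ β) E⊛β))) (⊛-congˡ β E⊛β) ⟩
  ((-S (β ⊛ β)) +S (-S ((tS ⊛ β) ⊛ cS 1ℚ))) +S (β ⊛ cS 1ℚ)
    ≈⟨ S.solve 2 (λ b t → ((S.:- (b S.:* b)) S.:- t S.:* b S.:* S.con 1ℚ) S.:+ b S.:* S.con 1ℚ S.:= (b S.:- t S.:* b) S.:- b S.:* b) (λ _ → refl) β tS ⟩
  (β +S (-S (tS ⊛ β))) +S (-S (β ⊛ β)) ∎
  where
  open import Relation.Binary.Reasoning.Setoid R.setoid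
  -- differentiate E·β = 1
  derivative-of-one : ((θ E ⊛ β) +S (E ⊛ θ β)) ≗ cS 0ℚ
  derivative-of-one = R.trans (R.sym (θ-leibniz E β)) (R.trans (θ-cong E⊛β) (θ-constant 1ℚ))

isolate : ∀ a b c g → a ≡ ((a - b) - g) + c → g ≡ c - b
isolate a b c g eq = begin
  g                                 ≡⟨ solve 4 (λ a b c g → g := (c :- b) :- ((((a :- b) :- g) :+ c) :- a)) refl a b c g ⟩
  (c - b) - ((((a - b) - g) + c) - a) ≡⟨ cong (λ z → (c - b) - (z - a)) (sym eq) ⟩
  (c - b) - (a - a)                 ≡⟨ solve 3 (λ a b c → (c :- b) :- (a :- a) := c :- b) refl a b c ⟩
  c - b                             ∎
  where open ≡-Reasoning

-- Comparing coefficients of t^(r+1) in the differential equation of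
-- β^(r+1)·e^{yt} gives the recurrence between consecutive orders
--   (r+1) [t^(r+1)] β^(r+2)e^{yt} = (y − (r+1)) [t^r] β^(r+1)e^{yt}.
module BernoulliOrders (y : ℚ) (r : ℕ) where
  private
    N : ℚ
    N = ℕ→ℚ (suc r)
    c Y e G₁ G₂ : Series
    c = cS N
    Y = cS y
    e = expS y
    G₁ = powS β (suc r) ⊛ e
    G₂ = powS β (suc (suc r)) ⊛ e

  θ-G₁ : θ G₁ ≗ ((((c ⊛ G₁) +S (-S (c ⊛ (tS ⊛ G₁)))) +S (-S (c ⊛ G₂))) +S (Y ⊛ (tS ⊛ G₁)))
  θ-G₁ = begin
    θ G₁
      ≈⟨ θ-leibniz (powS β (suc r)) e ⟩
    (θ (powS β (suc r)) ⊛ e) +S (powS β (suc r) ⊛ θ e)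
      ≈⟨ +S-cong (⊛-congʳ e (R.trans (θ-powS β r) (⊛-congˡ c (⊛-congʳ (powS β r) θ-bernGen)))) (⊛-congˡ (powS β (suc r)) (θ-expS y)) ⟩
    ((c ⊛ ((((β +S (-S (tS ⊛ β))) +S (-S (β ⊛ β)))) ⊛ powS β r)) ⊛ e) +S ((β ⊛ powS β r) ⊛ (Y ⊛ (tS ⊛ e)))
      ≈⟨ S.solve 6 (λ c b t p e Y → (c S.:* (((b S.:- t S.:* b) S.:- b S.:* b) S.:* p)) S.:* e S.:+ (b S.:* p) S.:* (Y S.:* (t S.:* e))
               S.:= (((c S.:* ((b S.:* p) S.:* e)) S.:- (c S.:* (t S.:* ((b S.:* p) S.:* e)))) S.:- (c S.:* ((b S.:* (b S.:* p)) S.:* e))) S.:+ (Y S.:* (t S.:* ((b S.:* p) S.:* e))))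
           (λ _ → refl) c β tS (powS β r) e Y ⟩
    (((c ⊛ G₁) +S (-S (c ⊛ (tS ⊛ G₁)))) +S (-S (c ⊛ G₂))) +S (Y ⊛ (tS ⊛ G₁)) ∎
    where open import Relation.Binary.Reasoning.Setoid R.setoid

  coefficient : N * G₁ (suc r) ≡ ((N * G₁ (suc r) - N * G₁ r) - N * G₂ (suc r)) + y * G₁ r
  coefficient = trans (θ-G₁ (suc r))
    (cong₂ _+_ (cong₂ _+_ (cong₂ _+_ (cS-⊛ N G₁ (suc r)) (cong -_ (trans (cS-⊛ N (tS ⊛ G₁) (suc r)) (cong (N *_) (tS-⊛-suc G₁ r)))))
                          (cong -_ (cS-⊛ N G₂ (suc r))))
               (trans (cS-⊛ y (tS ⊛ G₁) (suc r)) (cong (y *_) (tS-⊛-suc G₁ r))))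

  order-step : N * G₂ (suc r) ≡ (y - N) * G₁ r
  order-step = trans (isolate (N * G₁ (suc r)) (N * G₁ r) (y * G₁ r) (N * G₂ (suc r)) coefficient)
    (solve 3 (λ n y g → y :* g :- n :* g := (y :- n) :* g) refl N y (G₁ r))

B-order-step : ∀ y r → B (suc (suc r)) (suc r) y ≡ (y - ℕ→ℚ (suc r)) * B (suc r) r y
B-order-step y r = begin
  ℕ→ℚ (suc r ℕ.* r ℕ.!) * g₂                   ≡⟨ cong (_* g₂) (ℕ→ℚ-* (suc r) (r ℕ.!)) ⟩
  ℕ→ℚ (suc r) * ℕ→ℚ (r ℕ.!) * g₂               ≡⟨ solve 3 (λ n f g → n :* f :* g := f :* (n :* g)) refl (ℕ→ℚ (suc r)) (ℕ→ℚ (r ℕ.!)) g₂ ⟩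
  ℕ→ℚ (r ℕ.!) * (ℕ→ℚ (suc r) * g₂)             ≡⟨ cong (ℕ→ℚ (r ℕ.!) *_) (BernoulliOrders.order-step y r) ⟩
  ℕ→ℚ (r ℕ.!) * ((y - ℕ→ℚ (suc r)) * g₁)       ≡⟨ solve 3 (λ f a g → f :* (a :* g) := a :* (f :* g)) refl (ℕ→ℚ (r ℕ.!)) (y - ℕ→ℚ (suc r)) g₁ ⟩
  (y - ℕ→ℚ (suc r)) * (ℕ→ℚ (r ℕ.!) * g₁)       ∎
  where
  open ≡-Reasoning
  g₁ g₂ : ℚ
  g₂ = (powS β (suc (suc r)) ⊛ expS y) (suc r)
  g₁ = (powS β (suc r) ⊛ expS y) r

B-diagonal : ∀ m y → B (suc m) m y ≡ falling (y - 1ℚ) m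
B-diagonal zero    y = refl
B-diagonal (suc m) y = begin
  B (suc (suc m)) (suc m) y                   ≡⟨ B-order-step y m ⟩
  (y - ℕ→ℚ (suc m)) * B (suc m) m y           ≡⟨ cong₂ (λ a b → (y - a) * b) (ℕ→ℚ-suc m) (B-diagonal m y) ⟩
  (y - (1ℚ + ℕ→ℚ m)) * falling (y - 1ℚ) m    ≡⟨ solve 3 (λ y n f → (y :- (con 1ℚ :+ n)) :* f := f :* ((y :- con 1ℚ) :- n)) refl y (ℕ→ℚ m) (falling (y - 1ℚ) m) ⟩
  falling (y - 1ℚ) m * ((y - 1ℚ) - ℕ→ℚ m)     ∎
  where open ≡-Reasoning

falling-suc : ∀ a k → falling (1ℚ + a) (suc k) ≡ (1ℚ + a) * falling a k
falling-suc a zero    = solve 1 (λ a → con 1ℚ :* ((con 1ℚ :+ a) :- con 0ℚ) := (con 1ℚ :+ a) :* con 1ℚ) refl a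
falling-suc a (suc k) = begin
  falling (1ℚ + a) (suc k) * ((1ℚ + a) - ℕ→ℚ (suc k))     ≡⟨ cong₂ (λ u v → u * ((1ℚ + a) - v)) (falling-suc a k) (ℕ→ℚ-suc k) ⟩
  (1ℚ + a) * falling a k * ((1ℚ + a) - (1ℚ + ℕ→ℚ k))    ≡⟨ solve 3 (λ a F n → (con 1ℚ :+ a) :* F :* ((con 1ℚ :+ a) :- (con 1ℚ :+ n)) := (con 1ℚ :+ a) :* (F :* (a :- n))) refl a (falling a k) (ℕ→ℚ k) ⟩
  (1ℚ + a) * (falling a k * (a - ℕ→ℚ k))                ∎
  where open ≡-Reasoning

binomS-one : ∀ a → binomS a 1 ≡ a
binomS-one a = solve 1 (λ a → (con 1ℚ :* (a :- con 0ℚ)) :* (con 1ℚ :* con 1ℚ) := a) refl a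

binomS-suc : ∀ a k → ℕ→ℚ (suc k) * binomS a (suc k) ≡ (a - ℕ→ℚ k) * binomS a k
binomS-suc a k = trans
  (solve 4 (λ n F q I → n :* ((F :* q) :* I) := q :* (F :* (n :* I))) refl (ℕ→ℚ (suc k)) (falling a k) (a - ℕ→ℚ k) (invFact (suc k)))
  (cong (λ z → (a - ℕ→ℚ k) * (falling a k * z)) (invFact-suc k))

binomS-absorb : ∀ a j → ℕ→ℚ (suc j) * binomS (1ℚ + a) (suc j) ≡ (1ℚ + a) * binomS a j
binomS-absorb a j = begin
  ℕ→ℚ (suc j) * (falling (1ℚ + a) (suc j) * invFact (suc j))    ≡⟨ cong (λ z → ℕ→ℚ (suc j) * (z * invFact (suc j))) (falling-suc a j) ⟩
  ℕ→ℚ (suc j) * (((1ℚ + a) * falling a j) * invFact (suc j))    ≡⟨ solve 4 (λ n a F I → n :* ((a :* F) :* I) := a :* (F :* (n :* I))) refl (ℕ→ℚ (suc j)) (1ℚ + a) (falling a j) (invFact (suc j)) ⟩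
  (1ℚ + a) * (falling a j * (ℕ→ℚ (suc j) * invFact (suc j)))    ≡⟨ cong (λ z → (1ℚ + a) * (falling a j * z)) (invFact-suc j) ⟩
  (1ℚ + a) * binomS a j                                        ∎
  where open ≡-Reasoning

binomS-pascal : ∀ a k → binomS (1ℚ + a) (suc k) ≡ binomS a (suc k) + binomS a k
binomS-pascal a k = begin
  falling (1ℚ + a) (suc k) * I                        ≡⟨ cong (_* I) (falling-suc a k) ⟩
  (1ℚ + a) * falling a k * I                          ≡⟨ solve 4 (λ a F n I → (con 1ℚ :+ a) :* F :* I := (F :* (a :- n)) :* I :+ F :* ((con 1ℚ :+ n) :* I)) refl a (falling a k) (ℕ→ℚ k) I ⟩
  falling a (suc k) * I + falling a k * ((1ℚ + ℕ→ℚ k) * I)  ≡⟨ cong (λ z → falling a (suc k) * I + falling a k * (z * I)) (sym (ℕ→ℚ-suc k)) ⟩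
  falling a (suc k) * I + falling a k * (ℕ→ℚ (suc k) * I)   ≡⟨ cong (λ z → falling a (suc k) * I + falling a k * z) (invFact-suc k) ⟩
  binomS a (suc k) + binomS a k                       ∎
  where
  open ≡-Reasoning
  I : ℚ
  I = invFact (suc k)

C≡binomS : ∀ n k → ℕ→ℚ (n C k) ≡ binomS (ℕ→ℚ n) k
C≡binomS zero    zero    = refl
C≡binomS zero    (suc k) = sym (trans (cong (_* invFact (suc k)) (falling-zero k)) (*-zeroˡ (invFact (suc k))))
  where
  falling-zero : ∀ k → falling 0ℚ (suc k) ≡ 0ℚ
  falling-zero zero    = refl
  falling-zero (suc k) = trans (cong (_* (0ℚ - ℕ→ℚ (suc k))) (falling-zero k)) (*-zeroˡ (0ℚ - ℕ→ℚ (suc k)))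
C≡binomS (suc n) zero    = refl
C≡binomS (suc n) (suc k) = begin
  ℕ→ℚ (suc n C suc k)                                  ≡⟨ cong ℕ→ℚ (sym (nCk+nC[k+1]≡[n+1]C[k+1] n k)) ⟩
  ℕ→ℚ (n C k ℕ.+ n C suc k)                            ≡⟨ ℕ→ℚ-+ (n C k) (n C suc k) ⟩
  ℕ→ℚ (n C k) + ℕ→ℚ (n C suc k)                        ≡⟨ cong₂ _+_ (C≡binomS n k) (C≡binomS n (suc k)) ⟩
  binomS (ℕ→ℚ n) k + binomS (ℕ→ℚ n) (suc k)            ≡⟨ solve 2 (λ a b → a :+ b := b :+ a) refl (binomS (ℕ→ℚ n) k) (binomS (ℕ→ℚ n) (suc k)) ⟩
  binomS (ℕ→ℚ n) (suc k) + binomS (ℕ→ℚ n) k            ≡⟨ sym (binomS-pascal (ℕ→ℚ n) k) ⟩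
  binomS (1ℚ + ℕ→ℚ n) (suc k)                          ≡⟨ cong (λ z → binomS z (suc k)) (sym (ℕ→ℚ-suc n)) ⟩
  binomS (ℕ→ℚ (suc n)) (suc k)                         ∎
  where open ≡-Reasoning

falling≡fact*binomS : ∀ y m → falling y m ≡ ℕ→ℚ (m ℕ.!) * binomS y m
falling≡fact*binomS y m = sym (begin
  ℕ→ℚ (m ℕ.!) * (falling y m * invFact m)   ≡⟨ solve 3 (λ M F I → M :* (F :* I) := F :* (M :* I)) refl (ℕ→ℚ (m ℕ.!)) (falling y m) (invFact m) ⟩
  falling y m * (ℕ→ℚ (m ℕ.!) * invFact m)   ≡⟨ cong (falling y m *_) (fact*invFact m) ⟩
  falling y m * 1ℚ                          ≡⟨ solve 1 (λ F → F :* con 1ℚ := F) refl (falling y m) ⟩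
  falling y m                               ∎)
  where open ≡-Reasoning

binomS-shift : ∀ a → binomS (1ℚ + a) ≗ ((cS 1ℚ +S tS) ⊛ binomS a)
binomS-shift a zero    = sym (trans (⊛-distribʳ (binomS a) (cS 1ℚ) tS 0)
  (trans (cong₂ _+_ (cS-⊛ 1ℚ (binomS a) 0) (tS-⊛-zero (binomS a))) refl))
binomS-shift a (suc k) = trans (binomS-pascal a k) (sym (trans (⊛-distribʳ (binomS a) (cS 1ℚ) tS (suc k))
  (cong₂ _+_ (trans (cS-⊛ 1ℚ (binomS a) (suc k)) (*-identityˡ (binomS a (suc k)))) (tS-⊛-suc (binomS a) k))))

-- (1+t)^a solves  (1+t)·θf = a·t·f,  written as  θf = t·(a f − θf).
θ-binomS : ∀ a → θ (binomS a) ≗ (tS ⊛ ((cS a ⊛ binomS a) +S (-S θ (binomS a))))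
θ-binomS a zero    = trans (*-zeroˡ (binomS a 0)) (sym (tS-⊛-zero ((cS a ⊛ binomS a) +S (-S θ (binomS a)))))
θ-binomS a (suc k) = trans (binomS-suc a k) (sym (begin
  (tS ⊛ ((cS a ⊛ binomS a) +S (-S θ (binomS a)))) (suc k)   ≡⟨ tS-⊛-suc ((cS a ⊛ binomS a) +S (-S θ (binomS a))) k ⟩
  (cS a ⊛ binomS a) k + (- (ℕ→ℚ k * binomS a k))            ≡⟨ cong (_+ (- (ℕ→ℚ k * binomS a k))) (cS-⊛ a (binomS a) k) ⟩
  a * binomS a k + (- (ℕ→ℚ k * binomS a k))                 ≡⟨ solve 3 (λ a n b → a :* b :+ (:- (n :* b)) := (a :- n) :* b) refl a (ℕ→ℚ k) (binomS a k) ⟩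
  (a - ℕ→ℚ k) * binomS a k                                  ∎))
  where open ≡-Reasoning

negArg-θ : ∀ f → θ (negArg f) ≗ negArg (θ f)
negArg-θ f k = solve 3 (λ n s a → n :* (s :* a) := s :* (n :* a)) refl (ℕ→ℚ k) (sgn k) (f k)

negArg-+S : ∀ f g → negArg (f +S g) ≗ (negArg f +S negArg g)
negArg-+S f g k = solve 3 (λ s a b → s :* (a :+ b) := s :* a :+ s :* b) refl (sgn k) (f k) (g k)

negArg--S : ∀ f → negArg (-S f) ≗ (-S negArg f)
negArg--S f k = solve 2 (λ s a → s :* (:- a) := :- (s :* a)) refl (sgn k) (f k)

negArg-cS : ∀ a f → negArg (cS a ⊛ f) ≗ (cS a ⊛ negArg f)
negArg-cS a f k = trans (cong (sgn k *_) (cS-⊛ a f k)) (sym (trans (cS-⊛ a (negArg f) k)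
  (solve 3 (λ a s b → a :* (s :* b) := s :* (a :* b)) refl a (sgn k) (f k))))

negArg-tS : ∀ f → negArg (tS ⊛ f) ≗ (-S (tS ⊛ negArg f))
negArg-tS f zero    = trans (cong (1ℚ *_) (tS-⊛-zero f)) (sym (cong -_ (tS-⊛-zero (negArg f))))
negArg-tS f (suc k) = trans (cong (sgn (suc k) *_) (tS-⊛-suc f k)) (sym (trans (cong -_ (tS-⊛-suc (negArg f) k))
  (solve 2 (λ s b → :- (s :* b) := (:- s) :* b) refl (sgn k) (f k))))

θ-negArg-binomS : ∀ a → θ (negArg (binomS a)) ≗ (-S (tS ⊛ ((cS a ⊛ negArg (binomS a)) +S (-S θ (negArg (binomS a))))))
θ-negArg-binomS a = begin
  θ (negArg b)                                                ≈⟨ negArg-θ b ⟩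
  negArg (θ b)                                                ≈⟨ (λ k → cong (sgn k *_) (θ-binomS a k)) ⟩
  negArg (tS ⊛ ((cS a ⊛ b) +S (-S θ b)))                      ≈⟨ negArg-tS ((cS a ⊛ b) +S (-S θ b)) ⟩
  -S (tS ⊛ negArg ((cS a ⊛ b) +S (-S θ b)))                   ≈⟨ -S-cong (⊛-congˡ tS inner) ⟩
  -S (tS ⊛ ((cS a ⊛ negArg b) +S (-S θ (negArg b))))          ∎
  where
  open import Relation.Binary.Reasoning.Setoid R.setoid
  b : Series
  b = binomS a
  inner : negArg ((cS a ⊛ b) +S (-S θ b)) ≗ ((cS a ⊛ negArg b) +S (-S θ (negArg b)))
  inner = R.trans (negArg-+S (cS a ⊛ b) (-S θ b))
            (+S-cong (negArg-cS a b) (R.trans (negArg--S (θ b)) (-S-cong (R.sym (negArg-θ b)))))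

residual : ∀ {f g} → f ≗ g → (f +S (-S g)) ≗ cS 0ℚ
residual {f} {g} f≗g = R.trans (+S-congʳ (-S g) f≗g)
  (R.trans (S.solve 1 (λ g → g S.:+ (S.:- g) S.:= S.con 0ℚ) (λ _ → refl) g) (λ _ → refl))

-- The Pidduck generating function G = (1−t)^{-1}(1+t)^x(1−t)^{-x} satisfies
--   (1 − t²)·θG = t·((1+2x)·G + t·G),
-- i.e. the logarithmic derivative of G is ((1+2x) + t)/(1 − t²).  Comparing
-- coefficients yields a three-term recurrence for its coefficients.
module PidduckRecurrence (x : ℚ) where
  private
    A Bx Cx X G : Series
    A  = negArg (binomS (- 1ℚ))
    Bx = binomS x
    Cx = negArg (binomS (- x))
    X  = cS x
    G  = pidduckGen x

    -- the first-order equations of the three factors, in residual form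
    U₁ U₂ U₃ : Series
    U₁ = θ A +S (tS ⊛ ((cS (- 1ℚ) ⊛ A) +S (-S θ A)))
    U₂ = θ Bx +S (-S (tS ⊛ ((X ⊛ Bx) +S (-S θ Bx))))
    U₃ = θ Cx +S (tS ⊛ (((-S X) ⊛ Cx) +S (-S θ Cx)))

    double-negation : ∀ f → f ≗ (-S (-S f))
    double-negation f = S.solve 1 (λ z → z S.:= S.:- (S.:- z)) (λ _ → refl) f

    negated-constant : cS (- x) ≗ (-S X)
    negated-constant zero    = refl
    negated-constant (suc _) = refl

    U₁≗0 : U₁ ≗ cS 0ℚ
    U₁≗0 = R.trans (+S-congˡ (θ A) (double-negation _)) (residual (θ-negArg-binomS (- 1ℚ)))

    U₂≗0 : U₂ ≗ cS 0ℚ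
    U₂≗0 = residual (θ-binomS x)

    U₃≗0 : U₃ ≗ cS 0ℚ
    U₃≗0 = R.trans (+S-congˡ (θ Cx) (double-negation _))
      (residual (R.trans (θ-negArg-binomS (- x)) (-S-cong (⊛-congˡ tS (+S-congʳ (-S θ Cx) (⊛-congʳ Cx negated-constant))))))

    θG≗ : θ G ≗ ((((θ A ⊛ Bx) +S (A ⊛ θ Bx)) ⊛ Cx) +S ((A ⊛ Bx) ⊛ θ Cx))
    θG≗ = R.trans (θ-leibniz (A ⊛ Bx) Cx) (+S-congʳ ((A ⊛ Bx) ⊛ θ Cx) (⊛-congʳ Cx (θ-leibniz A Bx)))

    F RHS : Series
    F   = (((cS 1ℚ +S X) +S X) ⊛ G) +S (tS ⊛ G)
    RHS = tS ⊛ F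

  -- By the Leibniz rule, (1−t²)θG − RHS equals (1+t)·Bx·Cx·U₁ + (1−t)·A·Cx·U₂
  -- + (1+t)·A·Bx·U₃, a ring identity checked by the solver.
  ode : (θ G +S (-S (tS ⊛ (tS ⊛ θ G)))) ≗ RHS
  ode = begin
    θ G +S (-S (tS ⊛ (tS ⊛ θ G)))
      ≈⟨ +S-cong θG≗ (-S-cong (⊛-congˡ tS (⊛-congˡ tS θG≗))) ⟩
    θG′ +S (-S (tS ⊛ (tS ⊛ θG′)))
      ≈⟨ S.solve 8 (λ a b c ta tb tc t X →
          let G  = (a S.:* b) S.:* c
              θG = (((ta S.:* b) S.:+ (a S.:* tb)) S.:* c) S.:+ ((a S.:* b) S.:* tc)
              u₁ = ta S.:+ (t S.:* ((S.con (- 1ℚ) S.:* a) S.:+ (S.:- ta)))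
              u₂ = tb S.:+ (S.:- (t S.:* ((X S.:* b) S.:+ (S.:- tb))))
              u₃ = tc S.:+ (t S.:* (((S.:- X) S.:* c) S.:+ (S.:- tc)))
          in θG S.:+ (S.:- (t S.:* (t S.:* θG))) S.:=
             (t S.:* ((((S.con 1ℚ S.:+ X) S.:+ X) S.:* G) S.:+ (t S.:* G))) S.:+
             (((((S.con 1ℚ S.:+ t) S.:* (b S.:* c)) S.:* u₁) S.:+ (((S.con 1ℚ S.:+ (S.:- t)) S.:* (a S.:* c)) S.:* u₂)) S.:+ (((S.con 1ℚ S.:+ t) S.:* (a S.:* b)) S.:* u₃)))
          (λ _ → refl) A Bx Cx (θ A) (θ Bx) (θ Cx) tS X ⟩
    RHS +S (((k₁ ⊛ U₁) +S (k₂ ⊛ U₂)) +S (k₃ ⊛ U₃))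
      ≈⟨ +S-congˡ RHS (+S-cong (+S-cong (⊛-congˡ k₁ U₁≗0) (⊛-congˡ k₂ U₂≗0)) (⊛-congˡ k₃ U₃≗0)) ⟩
    RHS +S (((k₁ ⊛ cS 0ℚ) +S (k₂ ⊛ cS 0ℚ)) +S (k₃ ⊛ cS 0ℚ))
      ≈⟨ S.solve 4 (λ T p q r → T S.:+ (((p S.:* S.con 0ℚ) S.:+ (q S.:* S.con 0ℚ)) S.:+ (r S.:* S.con 0ℚ)) S.:= T) (λ _ → refl) RHS k₁ k₂ k₃ ⟩
    RHS ∎
    where
    open import Relation.Binary.Reasoning.Setoid R.setoid
    θG′ k₁ k₂ k₃ : Series
    θG′ = (((θ A ⊛ Bx) +S (A ⊛ θ Bx)) ⊛ Cx) +S ((A ⊛ Bx) ⊛ θ Cx)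
    k₁ = (cS 1ℚ +S tS) ⊛ (Bx ⊛ Cx)
    k₂ = (cS 1ℚ +S (-S tS)) ⊛ (A ⊛ Cx)
    k₃ = (cS 1ℚ +S tS) ⊛ (A ⊛ Bx)

  -- ω = 1 + 2x is the constant coefficient of the logarithmic derivative.
  ω : ℚ
  ω = (1ℚ + x) + x

  private
    ω-coefficient : ∀ k → (((cS 1ℚ +S X) +S X) ⊛ G) k ≡ ω * G k
    ω-coefficient k = trans (⊛-congʳ G constant k) (cS-⊛ ω G k)
      where
      constant : ((cS 1ℚ +S X) +S X) ≗ cS ω
      constant zero    = refl
      constant (suc _) = refl

    move : ∀ a b c → a + (- b) ≡ c → a ≡ c + b
    move a b c eq = begin
      a               ≡⟨ solve 2 (λ a b → a := (a :+ (:- b)) :+ b) refl a b ⟩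
      (a + (- b)) + b ≡⟨ cong (_+ b) eq ⟩
      c + b           ∎
      where open ≡-Reasoning

    coefficient : ∀ k → ℕ→ℚ k * G k ≡ RHS k + (tS ⊛ (tS ⊛ θ G)) k
    coefficient k = move (ℕ→ℚ k * G k) ((tS ⊛ (tS ⊛ θ G)) k) (RHS k) (ode k)

  pidduck-one : G 1 ≡ ω * G 0
  pidduck-one = begin
    G 1                                        ≡⟨ solve 1 (λ g → g := con 1ℚ :* g) refl (G 1) ⟩
    1ℚ * G 1                                   ≡⟨ coefficient 1 ⟩
    RHS 1 + (tS ⊛ (tS ⊛ θ G)) 1                ≡⟨ cong₂ _+_ (tS-⊛-suc F 0) (tS-⊛-suc (tS ⊛ θ G) 0) ⟩
    ((((cS 1ℚ +S X) +S X) ⊛ G) 0 + (tS ⊛ G) 0) + (tS ⊛ θ G) 0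
      ≡⟨ cong₂ _+_ (cong₂ _+_ (ω-coefficient 0) (tS-⊛-zero G)) (tS-⊛-zero (θ G)) ⟩
    (ω * G 0 + 0ℚ) + 0ℚ                        ≡⟨ solve 1 (λ a → (a :+ con 0ℚ) :+ con 0ℚ := a) refl (ω * G 0) ⟩
    ω * G 0                                    ∎
    where open ≡-Reasoning

  pidduck-recurrence : ∀ m → ℕ→ℚ (suc (suc m)) * G (suc (suc m)) ≡ ω * G (suc m) + ℕ→ℚ (suc m) * G m
  pidduck-recurrence m = begin
    ℕ→ℚ (suc (suc m)) * G (suc (suc m))                  ≡⟨ coefficient (suc (suc m)) ⟩
    RHS (suc (suc m)) + (tS ⊛ (tS ⊛ θ G)) (suc (suc m))  ≡⟨ cong₂ _+_ (tS-⊛-suc F (suc m)) (trans (tS-⊛-suc (tS ⊛ θ G) (suc m)) (tS-⊛-suc (θ G) m)) ⟩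
    ((((cS 1ℚ +S X) +S X) ⊛ G) (suc m) + (tS ⊛ G) (suc m)) + ℕ→ℚ m * G m
      ≡⟨ cong₂ (λ a b → (a + b) + ℕ→ℚ m * G m) (ω-coefficient (suc m)) (tS-⊛-suc G m) ⟩
    (ω * G (suc m) + G m) + ℕ→ℚ m * G m                  ≡⟨ solve 4 (λ a g n o → (a :+ g) :+ n :* g := a :+ (con 1ℚ :+ n) :* g) refl (ω * G (suc m)) (G m) (ℕ→ℚ m) 0ℚ ⟩
    ω * G (suc m) + (1ℚ + ℕ→ℚ m) * G m                   ≡⟨ cong (λ z → ω * G (suc m) + z * G m) (sym (ℕ→ℚ-suc m)) ⟩
    ω * G (suc m) + ℕ→ℚ (suc m) * G m                    ∎
    where open ≡-Reasoning

binomPredS : ℚ → ℕ → ℚ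
binomPredS a zero    = 0ℚ
binomPredS a (suc j) = binomS a j

binomPred≡binomPredS : ∀ n i → ℕ→ℚ (binomPred n i) ≡ binomPredS (ℕ→ℚ n) i
binomPred≡binomPredS n zero    = refl
binomPred≡binomPredS n (suc j) = C≡binomS n j

C≡0 : ∀ {n k} → n < k → ℕ→ℚ (n C k) ≡ 0ℚ
C≡0 n<k = cong ℕ→ℚ (k>n⇒nCk≡0 n<k)

binomS-three-term : ∀ a i →
  (1ℚ + (1ℚ + a)) * binomS (1ℚ + (1ℚ + a)) i
    ≡ ((ℕ→ℚ i + ℕ→ℚ i) + 1ℚ) * binomS (1ℚ + a) i + ℕ→ℚ i * binomPredS (1ℚ + a) i + (1ℚ + a) * binomS a i
binomS-three-term a zero = solve 1 (λ a → (con 1ℚ :+ (con 1ℚ :+ a)) :* (con 1ℚ :* con 1ℚ) := ((con 0ℚ :+ con 0ℚ) :+ con 1ℚ) :* (con 1ℚ :* con 1ℚ) :+ con 0ℚ :* con 0ℚ :+ (con 1ℚ :+ a) :* (con 1ℚ :* con 1ℚ)) refl a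
binomS-three-term a (suc zero) = begin
  (1ℚ + (1ℚ + a)) * binomS (1ℚ + (1ℚ + a)) 1       ≡⟨ cong ((1ℚ + (1ℚ + a)) *_) (binomS-one (1ℚ + (1ℚ + a))) ⟩
  (1ℚ + (1ℚ + a)) * (1ℚ + (1ℚ + a))                ≡⟨ solve 1 (λ a → (con 1ℚ :+ (con 1ℚ :+ a)) :* (con 1ℚ :+ (con 1ℚ :+ a)) := ((con 1ℚ :+ con 1ℚ) :+ con 1ℚ) :* (con 1ℚ :+ a) :+ con 1ℚ :* (con 1ℚ :* con 1ℚ) :+ (con 1ℚ :+ a) :* a) refl a ⟩
  ((1ℚ + 1ℚ) + 1ℚ) * (1ℚ + a) + 1ℚ * (1ℚ * 1ℚ) + (1ℚ + a) * a
    ≡⟨ cong₂ (λ u v → ((1ℚ + 1ℚ) + 1ℚ) * u + 1ℚ * (1ℚ * 1ℚ) + (1ℚ + a) * v) (sym (binomS-one (1ℚ + a))) (sym (binomS-one a)) ⟩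
  ((1ℚ + 1ℚ) + 1ℚ) * binomS (1ℚ + a) 1 + 1ℚ * (1ℚ * 1ℚ) + (1ℚ + a) * binomS a 1 ∎
  where open ≡-Reasoning
binomS-three-term a (suc (suc j)) = trans lhs (sym rhs)
  where
  open ≡-Reasoning
  u Nj I₂ A₁ A₂ N₂ : ℚ
  u  = falling a j
  Nj = ℕ→ℚ j
  I₂ = invFact (suc (suc j))
  A₁ = 1ℚ + a
  A₂ = 1ℚ + A₁
  N₂ = ℕ→ℚ (suc (suc j))
  -- every term is expanded to a multiple of falling a j
  lhs : A₂ * binomS A₂ (suc (suc j)) ≡ A₂ * ((A₂ * (A₁ * u)) * I₂)
  lhs = cong (λ z → A₂ * (z * I₂)) (trans (falling-suc A₁ (suc j)) (cong (A₂ *_) (falling-suc a j)))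
  rhs : ((N₂ + N₂) + 1ℚ) * binomS A₁ (suc (suc j)) + N₂ * binomS A₁ (suc j) + A₁ * binomS a (suc (suc j))
        ≡ A₂ * ((A₂ * (A₁ * u)) * I₂)
  rhs = begin
    ((N₂ + N₂) + 1ℚ) * (falling A₁ (suc (suc j)) * I₂) + N₂ * (falling A₁ (suc j) * invFact (suc j)) + A₁ * (falling a (suc (suc j)) * I₂)
      ≡⟨ cong (_+ A₁ * (falling a (suc (suc j)) * I₂))
           (cong₂ _+_ (cong (λ p → ((N₂ + N₂) + 1ℚ) * (p * I₂)) (falling-suc a (suc j)))
                      (cong₂ (λ q r → N₂ * (q * r)) (falling-suc a j) (sym (invFact-suc (suc j))))) ⟩
    ((N₂ + N₂) + 1ℚ) * ((A₁ * (u * (a - Nj))) * I₂) + N₂ * ((A₁ * u) * (N₂ * I₂)) + A₁ * ((u * (a - Nj) * (a - ℕ→ℚ (suc j))) * I₂)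
      ≡⟨ cong₂ (λ p q → ((p + p) + 1ℚ) * ((A₁ * (u * (a - Nj))) * I₂) + p * ((A₁ * u) * (p * I₂)) + A₁ * ((u * (a - Nj) * (a - q)) * I₂))
               (trans (ℕ→ℚ-suc (suc j)) (cong (1ℚ +_) (ℕ→ℚ-suc j))) (ℕ→ℚ-suc j) ⟩
    (((1ℚ + (1ℚ + Nj)) + (1ℚ + (1ℚ + Nj))) + 1ℚ) * ((A₁ * (u * (a - Nj))) * I₂) + (1ℚ + (1ℚ + Nj)) * ((A₁ * u) * ((1ℚ + (1ℚ + Nj)) * I₂)) + A₁ * ((u * (a - Nj) * (a - (1ℚ + Nj))) * I₂)
      ≡⟨ solve 4 (λ a j u I → (((con 1ℚ :+ (con 1ℚ :+ j)) :+ (con 1ℚ :+ (con 1ℚ :+ j))) :+ con 1ℚ) :* (((con 1ℚ :+ a) :* (u :* (a :- j))) :* I) :+ (con 1ℚ :+ (con 1ℚ :+ j)) :* (((con 1ℚ :+ a) :* u) :* ((con 1ℚ :+ (con 1ℚ :+ j)) :* I)) :+ (con 1ℚ :+ a) :* ((u :* (a :- j) :* (a :- (con 1ℚ :+ j))) :* I)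
                   := (con 1ℚ :+ (con 1ℚ :+ a)) :* (((con 1ℚ :+ (con 1ℚ :+ a)) :* ((con 1ℚ :+ a) :* u)) :* I)) refl a Nj u I₂ ⟩
    A₂ * ((A₂ * (A₁ * u)) * I₂) ∎

C-three-term : ∀ m i →
  ℕ→ℚ (suc (suc m)) * ℕ→ℚ (suc (suc m) C i)
    ≡ ((ℕ→ℚ i + ℕ→ℚ i) + 1ℚ) * ℕ→ℚ (suc m C i) + ℕ→ℚ i * ℕ→ℚ (binomPred (suc m) i) + ℕ→ℚ (suc m) * ℕ→ℚ (m C i)
C-three-term m i = begin
  ℕ→ℚ (suc (suc m)) * ℕ→ℚ (suc (suc m) C i)            ≡⟨ cong₂ _*_ m+2 (trans (C≡binomS (suc (suc m)) i) (cong (λ z → binomS z i) m+2)) ⟩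
  (1ℚ + (1ℚ + a)) * binomS (1ℚ + (1ℚ + a)) i          ≡⟨ binomS-three-term a i ⟩
  ((ℕ→ℚ i + ℕ→ℚ i) + 1ℚ) * binomS (1ℚ + a) i + ℕ→ℚ i * binomPredS (1ℚ + a) i + (1ℚ + a) * binomS a i
     ≡⟨ sym (cong₂ _+_ (cong₂ (λ p q → ((ℕ→ℚ i + ℕ→ℚ i) + 1ℚ) * p + ℕ→ℚ i * q)
                                (trans (C≡binomS (suc m) i) (cong (λ z → binomS z i) (ℕ→ℚ-suc m)))
                                (trans (binomPred≡binomPredS (suc m) i) (cong (λ z → binomPredS z i) (ℕ→ℚ-suc m))))
                       (cong₂ _*_ (ℕ→ℚ-suc m) (C≡binomS m i))) ⟩
  ((ℕ→ℚ i + ℕ→ℚ i) + 1ℚ) * ℕ→ℚ (suc m C i) + ℕ→ℚ i * ℕ→ℚ (binomPred (suc m) i) + ℕ→ℚ (suc m) * ℕ→ℚ (m C i) ∎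
  where
  open ≡-Reasoning
  a : ℚ
  a = ℕ→ℚ m
  m+2 : ℕ→ℚ (suc (suc m)) ≡ 1ℚ + (1ℚ + a)
  m+2 = trans (ℕ→ℚ-suc (suc m)) (cong (1ℚ +_) (ℕ→ℚ-suc m))

two : ℚ
two = 1ℚ + 1ℚ

twoPow : ℕ → ℚ
twoPow zero    = 1ℚ
twoPow (suc i) = two * twoPow i

-- The closed form  P_n(x) = n! · c_n  with  c_n = Σ_i C(n,i) 2^i C(x,i):
-- c satisfies the recurrence of the Pidduck coefficients, with the same
-- initial values.
module ClosedForm (x : ℚ) where
  open PidduckRecurrence x using (ω; pidduck-one; pidduck-recurrence)

  d : ℕ → ℚ
  d i = twoPow i * binomS x i

  c : ℕ → ℚ
  c n = sumTo n (λ i → ℕ→ℚ (n C i) * d i)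

  -- from (i+1)·C(x,i+1) = (x−i)·C(x,i):
  d-step : ∀ i → ω * d i ≡ ((ℕ→ℚ i + ℕ→ℚ i) + 1ℚ) * d i + ℕ→ℚ (suc i) * d (suc i)
  d-step i = sym (begin
    L * d i + ℕ→ℚ (suc i) * ((two * twoPow i) * binomS x (suc i))
      ≡⟨ cong (L * d i +_) (solve 3 (λ n t b → n :* (t :* b) := t :* (n :* b)) refl (ℕ→ℚ (suc i)) (two * twoPow i) (binomS x (suc i))) ⟩
    L * d i + (two * twoPow i) * (ℕ→ℚ (suc i) * binomS x (suc i))
      ≡⟨ cong (λ z → L * d i + (two * twoPow i) * z) (binomS-suc x i) ⟩
    L * (twoPow i * binomS x i) + (two * twoPow i) * ((x - ℕ→ℚ i) * binomS x i)
      ≡⟨ solve 4 (λ n t b x → ((n :+ n) :+ con 1ℚ) :* (t :* b) :+ ((con 1ℚ :+ con 1ℚ) :* t) :* ((x :- n) :* b) := ((con 1ℚ :+ x) :+ x) :* (t :* b)) refl (ℕ→ℚ i) (twoPow i) (binomS x i) x ⟩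
    ω * d i ∎)
    where
    open ≡-Reasoning
    L : ℚ
    L = (ℕ→ℚ i + ℕ→ℚ i) + 1ℚ

  c-one : c 1 ≡ ω * c 0
  c-one = begin
    1ℚ * (1ℚ * (1ℚ * 1ℚ)) + 1ℚ * ((two * 1ℚ) * binomS x 1)   ≡⟨ cong (λ z → 1ℚ * (1ℚ * (1ℚ * 1ℚ)) + 1ℚ * ((two * 1ℚ) * z)) (binomS-one x) ⟩
    1ℚ * (1ℚ * (1ℚ * 1ℚ)) + 1ℚ * ((two * 1ℚ) * x)            ≡⟨ solve 1 (λ x → con 1ℚ :* (con 1ℚ :* (con 1ℚ :* con 1ℚ)) :+ con 1ℚ :* (((con 1ℚ :+ con 1ℚ) :* con 1ℚ) :* x) := ((con 1ℚ :+ x) :+ x) :* (con 1ℚ :* (con 1ℚ :* (con 1ℚ :* con 1ℚ)))) refl x ⟩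
    ω * c 0                                                 ∎
    where open ≡-Reasoning

  c-recurrence : ∀ m → ℕ→ℚ (suc (suc m)) * c (suc (suc m)) ≡ ω * c (suc m) + ℕ→ℚ (suc m) * c m
  c-recurrence m = begin
    N₂ * c (suc (suc m))
      ≡⟨ sym (sum-*ˡ (suc (suc m)) N₂ _) ⟩
    sumTo (suc (suc m)) (λ i → N₂ * (ℕ→ℚ (suc (suc m) C i) * d i))
      ≡⟨ sum-cong (suc (suc m)) (λ i _ → split i) ⟩
    sumTo (suc (suc m)) (λ i → (R₁ i + R₂ i) + R₃ i)
      ≡⟨ trans (sum-+ (suc (suc m)) (λ i → R₁ i + R₂ i) R₃) (cong (_+ sumTo (suc (suc m)) R₃) (sum-+ (suc (suc m)) R₁ R₂)) ⟩
    (sumTo (suc (suc m)) R₁ + sumTo (suc (suc m)) R₂) + sumTo (suc (suc m)) R₃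
      ≡⟨ cong₂ _+_ (cong₂ _+_ ΣR₁ ΣR₂) ΣR₃ ⟩
    (sumTo (suc m) R₁ + sumTo (suc m) (λ i → R₂ (suc i))) + N₁ * c m
      ≡⟨ cong (_+ N₁ * c m) (sym (sum-+ (suc m) R₁ (λ i → R₂ (suc i)))) ⟩
    sumTo (suc m) (λ i → R₁ i + R₂ (suc i)) + N₁ * c m
      ≡⟨ cong (_+ N₁ * c m) (trans (sum-cong (suc m) (λ i _ → recombine i)) (sum-*ˡ (suc m) ω _)) ⟩
    ω * c (suc m) + N₁ * c m ∎
    where
    open ≡-Reasoning
    N₁ N₂ : ℚ
    N₂ = ℕ→ℚ (suc (suc m))
    N₁ = ℕ→ℚ (suc m)
    L : ℕ → ℚ
    L i = (ℕ→ℚ i + ℕ→ℚ i) + 1ℚ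
    R₁ R₂ R₃ : ℕ → ℚ
    R₁ i = ℕ→ℚ (suc m C i) * (L i * d i)
    R₂ i = ℕ→ℚ (binomPred (suc m) i) * (ℕ→ℚ i * d i)
    R₃ i = N₁ * (ℕ→ℚ (m C i) * d i)

    split : ∀ i → N₂ * (ℕ→ℚ (suc (suc m) C i) * d i) ≡ (R₁ i + R₂ i) + R₃ i
    split i = begin
      N₂ * (ℕ→ℚ (suc (suc m) C i) * d i)  ≡⟨ solve 3 (λ a b c → a :* (b :* c) := (a :* b) :* c) refl N₂ (ℕ→ℚ (suc (suc m) C i)) (d i) ⟩
      (N₂ * ℕ→ℚ (suc (suc m) C i)) * d i  ≡⟨ cong (_* d i) (C-three-term m i) ⟩
      (L i * ℕ→ℚ (suc m C i) + ℕ→ℚ i * ℕ→ℚ (binomPred (suc m) i) + N₁ * ℕ→ℚ (m C i)) * d i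
        ≡⟨ solve 7 (λ l p n q N s D → (l :* p :+ n :* q :+ N :* s) :* D := (p :* (l :* D) :+ q :* (n :* D)) :+ N :* (s :* D))
                 refl (L i) (ℕ→ℚ (suc m C i)) (ℕ→ℚ i) (ℕ→ℚ (binomPred (suc m) i)) N₁ (ℕ→ℚ (m C i)) (d i) ⟩
      (R₁ i + R₂ i) + R₃ i                 ∎

    ΣR₁ : sumTo (suc (suc m)) R₁ ≡ sumTo (suc m) R₁
    ΣR₁ = sum-drop-last (suc m) R₁ (trans (cong (_* (L (suc (suc m)) * d (suc (suc m)))) (C≡0 (ℕP.n<1+n (suc m)))) (*-zeroˡ (L (suc (suc m)) * d (suc (suc m)))))

    ΣR₂ : sumTo (suc (suc m)) R₂ ≡ sumTo (suc m) (λ i → R₂ (suc i))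
    ΣR₂ = trans (sum-shift (suc m) R₂) (trans (cong (_+ sumTo (suc m) (λ i → R₂ (suc i))) (*-zeroˡ (0ℚ * d 0))) (+-identityˡ _))

    ΣR₃ : sumTo (suc (suc m)) R₃ ≡ N₁ * c m
    ΣR₃ = begin
      sumTo (suc (suc m)) R₃ ≡⟨ sum-drop-last (suc m) R₃ (vanishes (ℕP.m<n⇒m<1+n (ℕP.n<1+n m))) ⟩
      sumTo (suc m) R₃       ≡⟨ sum-drop-last m R₃ (vanishes (ℕP.n<1+n m)) ⟩
      sumTo m R₃             ≡⟨ sum-*ˡ m N₁ _ ⟩
      N₁ * c m               ∎
      where
      vanishes : ∀ {i} → m < i → R₃ i ≡ 0ℚ
      vanishes {i} m<i = trans (cong (λ z → N₁ * (z * d i)) (C≡0 m<i))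
        (solve 2 (λ n e → n :* (con 0ℚ :* e) := con 0ℚ) refl N₁ (d i))

    recombine : ∀ i → R₁ i + R₂ (suc i) ≡ ω * (ℕ→ℚ (suc m C i) * d i)
    recombine i = begin
      ℕ→ℚ (suc m C i) * (L i * d i) + ℕ→ℚ (suc m C i) * (ℕ→ℚ (suc i) * d (suc i))  ≡⟨ sym (*-distribˡ-+ (ℕ→ℚ (suc m C i)) _ _) ⟩
      ℕ→ℚ (suc m C i) * (L i * d i + ℕ→ℚ (suc i) * d (suc i))                        ≡⟨ cong (ℕ→ℚ (suc m C i) *_) (sym (d-step i)) ⟩
      ℕ→ℚ (suc m C i) * (ω * d i)                                                    ≡⟨ solve 3 (λ a b c → a :* (b :* c) := b :* (a :* c)) refl (ℕ→ℚ (suc m C i)) ω (d i) ⟩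
      ω * (ℕ→ℚ (suc m C i) * d i)                                                    ∎

  -- Both sequences start with 1, ω and obey the same recurrence.
  pidduckGen≡c : ∀ n → (pidduckGen x n ≡ c n) × (pidduckGen x (suc n) ≡ c (suc n))
  pidduckGen≡c zero    = refl , trans pidduck-one (sym c-one)
  pidduckGen≡c (suc m) with pidduckGen≡c m
  ... | Gm≡cm , Gm+1≡cm+1 = Gm+1≡cm+1 , *-cancelˡ-suc (suc m) (begin
    ℕ→ℚ (suc (suc m)) * pidduckGen x (suc (suc m))            ≡⟨ pidduck-recurrence m ⟩
    ω * pidduckGen x (suc m) + ℕ→ℚ (suc m) * pidduckGen x m   ≡⟨ cong₂ (λ a b → ω * a + ℕ→ℚ (suc m) * b) Gm+1≡cm+1 Gm≡cm ⟩
    ω * c (suc m) + ℕ→ℚ (suc m) * c m                         ≡⟨ sym (c-recurrence m) ⟩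
    ℕ→ℚ (suc (suc m)) * c (suc (suc m))                       ∎)
    where open ≡-Reasoning

  P≡fact*c : ∀ n → P n x ≡ ℕ→ℚ (n ℕ.!) * c n
  P≡fact*c n = cong (ℕ→ℚ (n ℕ.!) *_) (proj₁ (pidduckGen≡c n))

sum-pascal : ∀ N (s : ℕ → ℚ) →
  sumTo (suc N) (λ j → ℕ→ℚ (suc N C j) * s j) ≡ sumTo N (λ j → ℕ→ℚ (N C j) * s j) + sumTo N (λ j → ℕ→ℚ (N C j) * s (suc j))
sum-pascal N s = begin
  sumTo (suc N) (λ j → ℕ→ℚ (suc N C j) * s j)
    ≡⟨ sum-shift N _ ⟩
  1ℚ * s 0 + sumTo N (λ j → ℕ→ℚ (suc N C suc j) * s (suc j))
    ≡⟨ cong (1ℚ * s 0 +_) (trans (sum-cong N (λ j _ → pascal j)) (sum-+ N _ _)) ⟩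
  1ℚ * s 0 + (sumTo N (λ j → ℕ→ℚ (N C suc j) * s (suc j)) + shifted)
    ≡⟨ solve 3 (λ a b c → a :+ (b :+ c) := (a :+ b) :+ c) refl (1ℚ * s 0) (sumTo N (λ j → ℕ→ℚ (N C suc j) * s (suc j))) shifted ⟩
  (1ℚ * s 0 + sumTo N (λ j → ℕ→ℚ (N C suc j) * s (suc j))) + shifted
    ≡⟨ cong (_+ shifted) (sym (sum-shift N (λ j → ℕ→ℚ (N C j) * s j))) ⟩
  sumTo (suc N) (λ j → ℕ→ℚ (N C j) * s j) + shifted
    ≡⟨ cong (_+ shifted) (sum-drop-last N _ (trans (cong (_* s (suc N)) (C≡0 (ℕP.n<1+n N))) (*-zeroˡ (s (suc N))))) ⟩
  sumTo N (λ j → ℕ→ℚ (N C j) * s j) + shifted ∎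
  where
  open ≡-Reasoning
  shifted : ℚ
  shifted = sumTo N (λ j → ℕ→ℚ (N C j) * s (suc j))
  pascal : ∀ j → ℕ→ℚ (suc N C suc j) * s (suc j) ≡ ℕ→ℚ (N C suc j) * s (suc j) + ℕ→ℚ (N C j) * s (suc j)
  pascal j = begin
    ℕ→ℚ (suc N C suc j) * s (suc j)                      ≡⟨ cong (λ z → ℕ→ℚ z * s (suc j)) (sym (nCk+nC[k+1]≡[n+1]C[k+1] N j)) ⟩
    ℕ→ℚ (N C j ℕ.+ N C suc j) * s (suc j)                ≡⟨ cong (_* s (suc j)) (ℕ→ℚ-+ (N C j) (N C suc j)) ⟩
    (ℕ→ℚ (N C j) + ℕ→ℚ (N C suc j)) * s (suc j)          ≡⟨ solve 3 (λ a b c → (a :+ b) :* c := b :* c :+ a :* c) refl (ℕ→ℚ (N C j)) (ℕ→ℚ (N C suc j)) (s (suc j)) ⟩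
    ℕ→ℚ (N C suc j) * s (suc j) + ℕ→ℚ (N C j) * s (suc j) ∎

C-absorb : ∀ m k → ℕ→ℚ (suc k) * ℕ→ℚ (suc m C suc k) ≡ ℕ→ℚ (suc m) * ℕ→ℚ (m C k)
C-absorb m k = begin
  ℕ→ℚ (suc k) * ℕ→ℚ (suc m C suc k)          ≡⟨ cong (ℕ→ℚ (suc k) *_) (trans (C≡binomS (suc m) (suc k)) (cong (λ z → binomS z (suc k)) (ℕ→ℚ-suc m))) ⟩
  ℕ→ℚ (suc k) * binomS (1ℚ + ℕ→ℚ m) (suc k)  ≡⟨ binomS-absorb (ℕ→ℚ m) k ⟩
  (1ℚ + ℕ→ℚ m) * binomS (ℕ→ℚ m) k           ≡⟨ cong₂ _*_ (sym (ℕ→ℚ-suc m)) (sym (C≡binomS m k)) ⟩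
  ℕ→ℚ (suc m) * ℕ→ℚ (m C k)                  ∎
  where open ≡-Reasoning

Q : Series
Q = cS two +S tS

W : ℕ → Series
W N = powS Q N

Q-⊛-zero : ∀ f → (Q ⊛ f) 0 ≡ two * f 0
Q-⊛-zero f = trans (⊛-distribʳ f (cS two) tS 0) (trans (cong₂ _+_ (cS-⊛ two f 0) (tS-⊛-zero f)) (+-identityʳ _))

Q-⊛-suc : ∀ f k → (Q ⊛ f) (suc k) ≡ two * f (suc k) + f k
Q-⊛-suc f k = trans (⊛-distribʳ f (cS two) tS (suc k)) (cong₂ _+_ (cS-⊛ two f (suc k)) (tS-⊛-suc f k))

W-coefficient : ∀ N k → W N k ≡ ℕ→ℚ (N C k) * twoPow (N ∸ k)
W-coefficient zero    zero    = refl
W-coefficient zero    (suc k) = refl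
W-coefficient (suc N) zero    = trans (Q-⊛-zero (W N)) (trans (cong (two *_) (W-coefficient N 0))
  (solve 1 (λ t → (con 1ℚ :+ con 1ℚ) :* (con 1ℚ :* t) := con 1ℚ :* ((con 1ℚ :+ con 1ℚ) :* t)) refl (twoPow N)))
W-coefficient (suc N) (suc k) = begin
  (Q ⊛ W N) (suc k)                                                       ≡⟨ Q-⊛-suc (W N) k ⟩
  two * W N (suc k) + W N k                                               ≡⟨ cong₂ (λ a b → two * a + b) (W-coefficient N (suc k)) (W-coefficient N k) ⟩
  two * (ℕ→ℚ (N C suc k) * twoPow (N ∸ suc k)) + ℕ→ℚ (N C k) * twoPow (N ∸ k)  ≡⟨ cong (_+ ℕ→ℚ (N C k) * twoPow (N ∸ k)) (lower-exponent k) ⟩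
  ℕ→ℚ (N C suc k) * twoPow (N ∸ k) + ℕ→ℚ (N C k) * twoPow (N ∸ k)         ≡⟨ solve 3 (λ a b t → a :* t :+ b :* t := (b :+ a) :* t) refl (ℕ→ℚ (N C suc k)) (ℕ→ℚ (N C k)) (twoPow (N ∸ k)) ⟩
  (ℕ→ℚ (N C k) + ℕ→ℚ (N C suc k)) * twoPow (N ∸ k)                        ≡⟨ cong (_* twoPow (N ∸ k)) (trans (sym (ℕ→ℚ-+ (N C k) (N C suc k))) (cong ℕ→ℚ (nCk+nC[k+1]≡[n+1]C[k+1] N k))) ⟩
  ℕ→ℚ (suc N C suc k) * twoPow (N ∸ k)                                    ∎
  where
  open ≡-Reasoning
  -- 2·2^(N−k−1) = 2^(N−k) when k < N; otherwise C(N,k+1) = 0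
  lower-exponent : ∀ k → two * (ℕ→ℚ (N C suc k) * twoPow (N ∸ suc k)) ≡ ℕ→ℚ (N C suc k) * twoPow (N ∸ k)
  lower-exponent k with k ℕ.<? N
  ... | yes k<N rewrite ℕP.+-∸-assoc 1 k<N =
    solve 2 (λ a t → (con 1ℚ :+ con 1ℚ) :* (a :* t) := a :* ((con 1ℚ :+ con 1ℚ) :* t)) refl (ℕ→ℚ (N C suc k)) (twoPow (N ∸ suc k))
  ... | no k≮N rewrite C≡0 (s≤s (ℕP.≮⇒≥ k≮N)) =
    solve 2 (λ a b → (con 1ℚ :+ con 1ℚ) :* (con 0ℚ :* a) := con 0ℚ :* b) refl (twoPow (N ∸ suc k)) (twoPow (N ∸ k))

-- Σ_j C(N,j)·C(y+j, k) = [t^k] (1+t)^y (2+t)^N,  by induction on N using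
-- Pascal's rule and (1+t)^(y+1) = (1+t)(1+t)^y.
binomial-sum : ℕ → ℚ → ℕ → ℚ
binomial-sum N y k = sumTo N (λ j → ℕ→ℚ (N C j) * binomS (y + ℕ→ℚ j) k)

binomial-sum-series : ∀ N y k → binomial-sum N y k ≡ (binomS y ⊛ W N) k
binomial-sum-series zero y k = begin
  1ℚ * binomS (y + 0ℚ) k  ≡⟨ trans (*-identityˡ _) (cong (λ z → binomS z k) (+-identityʳ y)) ⟩
  binomS y k              ≡⟨ sym (trans (⊛-comm (binomS y) oneS k) (⊛-identityˡ (binomS y) k)) ⟩
  (binomS y ⊛ oneS) k     ∎
  where open ≡-Reasoning
binomial-sum-series (suc N) y k = begin
  binomial-sum (suc N) y k
    ≡⟨ sum-pascal N (λ j → binomS (y + ℕ→ℚ j) k) ⟩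
  binomial-sum N y k + sumTo N (λ j → ℕ→ℚ (N C j) * binomS (y + ℕ→ℚ (suc j)) k)
    ≡⟨ cong (binomial-sum N y k +_) (sum-cong N (λ j _ → cong (λ z → ℕ→ℚ (N C j) * binomS z k) (shift j))) ⟩
  binomial-sum N y k + binomial-sum N (1ℚ + y) k
    ≡⟨ cong₂ _+_ (binomial-sum-series N y k) (binomial-sum-series N (1ℚ + y) k) ⟩
  (binomS y ⊛ W N) k + (binomS (1ℚ + y) ⊛ W N) k
    ≡⟨ cong ((binomS y ⊛ W N) k +_) (⊛-congʳ (W N) (binomS-shift y) k) ⟩
  (binomS y ⊛ W N) k + (((cS 1ℚ +S tS) ⊛ binomS y) ⊛ W N) k
    ≡⟨ S.solve 3 (λ b w t → b S.:* w S.:+ ((S.con 1ℚ S.:+ t) S.:* b) S.:* w S.:= b S.:* ((S.con two S.:+ t) S.:* w)) (λ _ → refl) (binomS y) (W N) tS k ⟩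
  (binomS y ⊛ W (suc N)) k ∎
  where
  open ≡-Reasoning
  shift : ∀ j → y + ℕ→ℚ (suc j) ≡ (1ℚ + y) + ℕ→ℚ j
  shift j = trans (cong (y +_) (ℕ→ℚ-suc j)) (solve 2 (λ y j → y :+ (con 1ℚ :+ j) := (con 1ℚ :+ y) :+ j) refl y (ℕ→ℚ j))

-- Factor out (2+t)^(m+1); the remaining series x(1+t)^y(2+t) + (1+t)^x has
-- coefficients (k+1)·(2C(x,k+1) + C(x,k)), and absorption and Pascal's rule
-- turn the resulting sum into the closed form c.
module KeyIdentity (x : ℚ) where
  open ClosedForm x using (c; d)

  y : ℚ
  y = x - 1ℚ

  absorb : ∀ j → ℕ→ℚ (suc j) * binomS x (suc j) ≡ x * binomS y j
  absorb j = subst (λ z → ℕ→ℚ (suc j) * binomS z (suc j) ≡ z * binomS y j)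
    (solve 1 (λ x → con 1ℚ :+ (x :- con 1ℚ) := x) refl x) (binomS-absorb y j)

  h : ℕ → ℚ
  h k = two * binomS x (suc k) + binomS x k

  H : Series
  H = (cS x ⊛ (binomS y ⊛ Q)) +S binomS x

  H-coefficient : ∀ k → H k ≡ ℕ→ℚ (suc k) * h k
  H-coefficient zero = begin
    (cS x ⊛ (binomS y ⊛ Q)) 0 + binomS x 0   ≡⟨ cong (_+ binomS x 0) (trans (cS-⊛ x (binomS y ⊛ Q) 0) (cong (x *_) (trans (⊛-comm (binomS y) Q 0) (Q-⊛-zero (binomS y))))) ⟩
    x * (two * (1ℚ * 1ℚ)) + 1ℚ * 1ℚ          ≡⟨ solve 1 (λ x → x :* ((con 1ℚ :+ con 1ℚ) :* (con 1ℚ :* con 1ℚ)) :+ con 1ℚ :* con 1ℚ := con 1ℚ :* ((con 1ℚ :+ con 1ℚ) :* x :+ con 1ℚ :* con 1ℚ)) refl x ⟩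
    1ℚ * (two * x + 1ℚ * 1ℚ)                 ≡⟨ cong (λ z → 1ℚ * (two * z + 1ℚ * 1ℚ)) (sym (binomS-one x)) ⟩
    ℕ→ℚ 1 * h 0                              ∎
    where open ≡-Reasoning
  H-coefficient (suc k) = begin
    (cS x ⊛ (binomS y ⊛ Q)) (suc k) + b₁
      ≡⟨ cong (_+ b₁) (trans (cS-⊛ x (binomS y ⊛ Q) (suc k)) (cong (x *_) (trans (⊛-comm (binomS y) Q (suc k)) (Q-⊛-suc (binomS y) k)))) ⟩
    x * (two * binomS y (suc k) + binomS y k) + b₁
      ≡⟨ solve 4 (λ x p q r → x :* ((con 1ℚ :+ con 1ℚ) :* p :+ q) :+ r := (con 1ℚ :+ con 1ℚ) :* (x :* p) :+ x :* q :+ r) refl x (binomS y (suc k)) (binomS y k) b₁ ⟩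
    two * (x * binomS y (suc k)) + x * binomS y k + b₁
      ≡⟨ cong₂ (λ a b → two * a + b + b₁) (sym (absorb (suc k))) (sym (absorb k)) ⟩
    two * (ℕ→ℚ (suc (suc k)) * b₂) + ℕ→ℚ (suc k) * b₁ + b₁
      ≡⟨ cong (λ z → two * (z * b₂) + ℕ→ℚ (suc k) * b₁ + b₁) (ℕ→ℚ-suc (suc k)) ⟩
    two * ((1ℚ + ℕ→ℚ (suc k)) * b₂) + ℕ→ℚ (suc k) * b₁ + b₁
      ≡⟨ solve 3 (λ n p q → (con 1ℚ :+ con 1ℚ) :* ((con 1ℚ :+ n) :* p) :+ n :* q :+ q := (con 1ℚ :+ n) :* ((con 1ℚ :+ con 1ℚ) :* p :+ q)) refl (ℕ→ℚ (suc k)) b₂ b₁ ⟩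
    (1ℚ + ℕ→ℚ (suc k)) * h (suc k)
      ≡⟨ cong (_* h (suc k)) (sym (ℕ→ℚ-suc (suc k))) ⟩
    ℕ→ℚ (suc (suc k)) * h (suc k) ∎
    where
    open ≡-Reasoning
    b₁ b₂ : ℚ
    b₁ = binomS x (suc k)
    b₂ = binomS x (suc (suc k))

  key-identity : ∀ m → x * (binomS y ⊛ W (suc (suc m))) m + (binomS x ⊛ W (suc m)) m ≡ two * ℕ→ℚ (suc m) * c (suc m)
  key-identity m = begin
    x * (binomS y ⊛ (Q ⊛ W₁)) m + (binomS x ⊛ W₁) m
      ≡⟨ cong (_+ (binomS x ⊛ W₁) m) (sym (cS-⊛ x (binomS y ⊛ (Q ⊛ W₁)) m)) ⟩
    (cS x ⊛ (binomS y ⊛ (Q ⊛ W₁))) m + (binomS x ⊛ W₁) m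
      ≡⟨ sym (S.solve 5 (λ X b q w bx → (X S.:* (b S.:* q) S.:+ bx) S.:* w S.:= X S.:* (b S.:* (q S.:* w)) S.:+ bx S.:* w) (λ _ → refl) (cS x) (binomS y) Q W₁ (binomS x) m) ⟩
    sumTo m (λ k → H k * W₁ (m ∸ k))
      ≡⟨ sum-cong m term ⟩
    sumTo m (λ k → two * N₁ * (ℕ→ℚ (m C k) * d k + ℕ→ℚ (m C k) * d (suc k)))
      ≡⟨ sum-*ˡ m (two * N₁) _ ⟩
    two * N₁ * sumTo m (λ k → ℕ→ℚ (m C k) * d k + ℕ→ℚ (m C k) * d (suc k))
      ≡⟨ cong (two * N₁ *_) (trans (sum-+ m _ _) (sym (sum-pascal m d))) ⟩
    two * N₁ * c (suc m) ∎
    where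
    open ≡-Reasoning
    W₁ : Series
    W₁ = W (suc m)
    N₁ : ℚ
    N₁ = ℕ→ℚ (suc m)
    term : ∀ k → k ≤ m → H k * W₁ (m ∸ k) ≡ two * N₁ * (ℕ→ℚ (m C k) * d k + ℕ→ℚ (m C k) * d (suc k))
    term k k≤m = begin
      H k * W₁ (m ∸ k)
        ≡⟨ cong₂ _*_ (H-coefficient k) (W-coefficient (suc m) (m ∸ k)) ⟩
      (ℕ→ℚ (suc k) * h k) * (ℕ→ℚ (suc m C (m ∸ k)) * twoPow (suc m ∸ (m ∸ k)))
        ≡⟨ cong₂ (λ a b → (ℕ→ℚ (suc k) * h k) * (ℕ→ℚ a * twoPow b)) (sym (nCk≡nC[n∸k] (s≤s k≤m)))
                 (trans (ℕP.+-∸-assoc 1 (ℕP.m∸n≤m m k)) (cong suc (ℕP.m∸[m∸n]≡n k≤m))) ⟩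
      (ℕ→ℚ (suc k) * h k) * (ℕ→ℚ (suc m C suc k) * twoPow (suc k))
        ≡⟨ solve 4 (λ n hh Cc t → (n :* hh) :* (Cc :* t) := (n :* Cc) :* (hh :* t)) refl (ℕ→ℚ (suc k)) (h k) (ℕ→ℚ (suc m C suc k)) (twoPow (suc k)) ⟩
      (ℕ→ℚ (suc k) * ℕ→ℚ (suc m C suc k)) * (h k * twoPow (suc k))
        ≡⟨ cong (_* (h k * twoPow (suc k))) (C-absorb m k) ⟩
      (N₁ * ℕ→ℚ (m C k)) * (h k * twoPow (suc k))
        ≡⟨ solve 5 (λ N Cc p q t → (N :* Cc) :* (((con 1ℚ :+ con 1ℚ) :* p :+ q) :* ((con 1ℚ :+ con 1ℚ) :* t)) := (con 1ℚ :+ con 1ℚ) :* N :* (Cc :* (t :* q) :+ Cc :* (((con 1ℚ :+ con 1ℚ) :* t) :* p))) refl N₁ (ℕ→ℚ (m C k)) (binomS x (suc k)) (binomS x k) (twoPow k) ⟩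
      two * N₁ * (ℕ→ℚ (m C k) * d k + ℕ→ℚ (m C k) * d (suc k)) ∎

-- The right-hand side of the theorem, using B_m^(m+1)(x+j) = m!·C(x+j−1, m),
-- as a combination of two binomial sums.
rhs-as-binomial-sums : ∀ m x →
  sumTo (suc (suc m)) (λ j → (ℕ→ℚ (suc (suc m) C j) * x + ℕ→ℚ (binomPred (suc m) j)) * B (suc m) m (x + ℕ→ℚ j))
    ≡ ℕ→ℚ (m ℕ.!) * (x * binomial-sum (suc (suc m)) (x - 1ℚ) m + binomial-sum (suc m) x m)
rhs-as-binomial-sums m x = begin
  sumTo (suc (suc m)) (λ j → (Cₘ₊₂ j * x + Pₘ₊₁ j) * B (suc m) m (x + ℕ→ℚ j))
    ≡⟨ sum-cong (suc (suc m)) (λ j _ → cong ((Cₘ₊₂ j * x + Pₘ₊₁ j) *_) (trans (B-diagonal m (x + ℕ→ℚ j)) (falling≡fact*binomS _ m))) ⟩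
  sumTo (suc (suc m)) (λ j → (Cₘ₊₂ j * x + Pₘ₊₁ j) * (M * b j))
    ≡⟨ sum-cong (suc (suc m)) (λ j _ → solve 5 (λ Cc x p M v → (Cc :* x :+ p) :* (M :* v) := (M :* x) :* (Cc :* v) :+ M :* (p :* v)) refl (Cₘ₊₂ j) x (Pₘ₊₁ j) M (b j)) ⟩
  sumTo (suc (suc m)) (λ j → (M * x) * (Cₘ₊₂ j * b j) + M * (Pₘ₊₁ j * b j))
    ≡⟨ trans (sum-+ (suc (suc m)) _ _) (cong₂ _+_ (sum-*ˡ (suc (suc m)) (M * x) _) (sum-*ˡ (suc (suc m)) M _)) ⟩
  (M * x) * sumTo (suc (suc m)) (λ j → Cₘ₊₂ j * b j) + M * sumTo (suc (suc m)) (λ j → Pₘ₊₁ j * b j)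
    ≡⟨ cong₂ (λ u v → (M * x) * u + M * v) first-sum second-sum ⟩
  (M * x) * binomial-sum (suc (suc m)) (x - 1ℚ) m + M * binomial-sum (suc m) x m
    ≡⟨ solve 4 (λ M x a b → (M :* x) :* a :+ M :* b := M :* (x :* a :+ b)) refl M x (binomial-sum (suc (suc m)) (x - 1ℚ) m) (binomial-sum (suc m) x m) ⟩
  M * (x * binomial-sum (suc (suc m)) (x - 1ℚ) m + binomial-sum (suc m) x m) ∎
  where
  open ≡-Reasoning
  M : ℚ
  M = ℕ→ℚ (m ℕ.!)
  Cₘ₊₂ Pₘ₊₁ b : ℕ → ℚ
  Cₘ₊₂ j = ℕ→ℚ (suc (suc m) C j)
  Pₘ₊₁ j = ℕ→ℚ (binomPred (suc m) j)
  b j = binomS ((x + ℕ→ℚ j) - 1ℚ) m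
  first-sum : sumTo (suc (suc m)) (λ j → Cₘ₊₂ j * b j) ≡ binomial-sum (suc (suc m)) (x - 1ℚ) m
  first-sum = sum-cong (suc (suc m)) (λ j _ → cong (λ z → Cₘ₊₂ j * binomS z m)
    (solve 2 (λ x j → (x :+ j) :- con 1ℚ := (x :- con 1ℚ) :+ j) refl x (ℕ→ℚ j)))
  -- binomPred shifts the index by one and vanishes at j = 0
  second-sum : sumTo (suc (suc m)) (λ j → Pₘ₊₁ j * b j) ≡ binomial-sum (suc m) x m
  second-sum = begin
    sumTo (suc (suc m)) (λ j → Pₘ₊₁ j * b j)         ≡⟨ sum-shift (suc m) _ ⟩
    0ℚ * b 0 + sumTo (suc m) (λ j → Pₘ₊₁ (suc j) * b (suc j))
      ≡⟨ trans (cong (_+ sumTo (suc m) (λ j → Pₘ₊₁ (suc j) * b (suc j))) (*-zeroˡ (b 0))) (+-identityˡ _) ⟩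
    sumTo (suc m) (λ j → Pₘ₊₁ (suc j) * b (suc j))
      ≡⟨ sum-cong (suc m) (λ j _ → cong (λ z → ℕ→ℚ (suc m C j) * binomS z m)
           (trans (cong (λ z → (x + z) - 1ℚ) (ℕ→ℚ-suc j)) (solve 2 (λ x j → (x :+ (con 1ℚ :+ j)) :- con 1ℚ := x :+ j) refl x (ℕ→ℚ j)))) ⟩
    binomial-sum (suc m) x m                        ∎

theorem8 : (n : ℕ) → 1 ≤ n → (x : ℚ) →
    P n x ≡ ½ * sumTo (suc n) (λ j →
    (ℕ→ℚ ((suc n) C j) * x + ℕ→ℚ (binomPred n j)) * B n (n ∸ 1) (x + ℕ→ℚ j))
theorem8 (suc m) _ x = sym (begin
  ½ * sumTo (suc (suc m)) (λ j → (ℕ→ℚ (suc (suc m) C j) * x + ℕ→ℚ (binomPred (suc m) j)) * B (suc m) m (x + ℕ→ℚ j))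
    ≡⟨ cong (½ *_) (rhs-as-binomial-sums m x) ⟩
  ½ * (M * (x * binomial-sum (suc (suc m)) y m + binomial-sum (suc m) x m))
    ≡⟨ cong₂ (λ u v → ½ * (M * (x * u + v))) (binomial-sum-series (suc (suc m)) y m) (binomial-sum-series (suc m) x m) ⟩
  ½ * (M * (x * (binomS y ⊛ W (suc (suc m))) m + (binomS x ⊛ W (suc m)) m))
    ≡⟨ cong (λ z → ½ * (M * z)) (key-identity m) ⟩
  ½ * (M * (two * ℕ→ℚ (suc m) * c (suc m)))
    ≡⟨ solve 3 (λ M N c → con ½ :* (M :* ((con 1ℚ :+ con 1ℚ) :* N :* c)) := (N :* M) :* c) refl M (ℕ→ℚ (suc m)) (c (suc m)) ⟩
  (ℕ→ℚ (suc m) * M) * c (suc m)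
    ≡⟨ cong (_* c (suc m)) (sym (ℕ→ℚ-* (suc m) (m ℕ.!))) ⟩
  ℕ→ℚ (suc m ℕ.!) * c (suc m)
    ≡⟨ sym (ClosedForm.P≡fact*c x (suc m)) ⟩
  P (suc m) x ∎)
  where
  open ≡-Reasoning
  open KeyIdentity x using (y; key-identity)
  open ClosedForm x using (c)
  M : ℚ
  M = ℕ→ℚ (m ℕ.!)
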